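{- Let $p\ge2$ and let $\phi$ be a power series of order $1$. Let $(T_i)_{i\in\mathbb N^2}$ be the dual coefficients of the Catalan power series $P(z,t)=t-t\phi(t^{p-1}z)$ and $\mathcal T_{\phi,p}(z)=\sum_{n\ge0}q^{ -(p-1)\binom n2}T_{n,n(p-1)+1}z^n$. Then $$\mathcal T_{\phi,p}(z)=\frac{[u^0]\Bigl(\theta\bigl(\frac{z}{uq},\frac1{q^{p-1}}\bigr)\Phi_{1/q}(u)\Bigr)}{[u^0]\Bigl(\theta\bigl(\frac{z}{u},\frac1{q^{p-1}}\bigr)\Phi_{1/q}(u)\Bigr)},$$ where $\theta(u,r)=\sum_{n\ge0}r^{\binom n2}u^n$ and $\Phi_{1/q}(u)=\prod_{n\ge0}\bigl(1-\phi(u/q^n)\bigr)$.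
   Context: $q$ is a fixed parameter; all series are formal and the infinite products are assumed to make sense. A Catalan power series is a power series $P(z,t)$ with $P(z,t)=t-z\tilde P(z,t)t^2$ for some power series $\tilde P$. Its predual basis is $\tilde e_i(z,t)=z^{i_1}\prod_{0\le j<i_2}P(q^jz,t)$ for $i=(i_1,i_2)\in\mathbb N^2$ (empty product $=1$), a basis of power series in $(z,t)$; the dual coefficients $(T_i)$ of $P$ are the unique numbers with $\sum_iT_i\tilde e_i(z,t)=t$. $[u^0]$ denotes the coefficient of $u^0$ in a series in $u$ and $u^{ -1}$. -}

module Defs where

open import Level using (Level; _⊔_)
open import Algebra.Bundles using (CommutativeRing)
open import Data.Nat as ℕ using (ℕ; zero; suc; _∸_; _≤_)
open import Data.Nat.Combinatorics using (_C_)
open import Data.Integer as ℤ using (ℤ; +_; -[1+_])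
open import Data.Product using (∃; ∃-syntax)
open import Relation.Nullary using (Dec; yes; no)

module Series {c ℓ : Level} (R : CommutativeRing c ℓ) where
  open CommutativeRing R

  sumR : ℕ → (ℕ → Carrier) → Carrier
  sumR zero    f = 0#
  sumR (suc n) f = sumR n f + f n

  ind : ∀ {a} {A : Set a} → Dec A → Carrier → Carrier
  ind (yes _) r = r
  ind (no _)  r = 0#

  -- Formal Laurent series in x = q⁻¹ over R (q is a formal parameter):
  -- the element  Σ_{m ≥ 0} cf m · q^(top - m).
  record Laur : Set c where
    constructor laur
    field
      top : ℤ
      cf  : ℕ → Carrier
  open Laur public

  coefAt : ℤ → (ℕ → Carrier) → Carrier
  coefAt (+ k)     f = f k
  coefAt -[1+ _ ]  f = 0#

  lc : Laur → ℤ → Carrier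
  lc x e = coefAt (top x ℤ.- e) (cf x)

  _≈L_ : Laur → Laur → Set ℓ
  x ≈L y = ∀ (e : ℤ) → lc x e ≈ lc y e

  embed : Carrier → Laur
  embed r = laur (+ 0) λ { zero → r ; (suc _) → 0# }

  0L 1L : Laur
  0L = embed 0#
  1L = embed 1#

  qpow : ℤ → Laur
  qpow e = laur e λ { zero → 1# ; (suc _) → 0# }

  _+L_ : Laur → Laur → Laur
  x +L y = laur t λ m → lc x (t ℤ.- + m) + lc y (t ℤ.- + m)
    where t = top x ℤ.⊔ top y

  -L_ : Laur → Laur
  -L x = laur (top x) λ m → - cf x m

  _-L_ : Laur → Laur → Laur
  x -L y = x +L (-L y)

  _*L_ : Laur → Laur → Laur
  x *L y = laur (top x ℤ.+ top y)
                λ m → sumR (suc m) λ a → cf x a * cf y (m ∸ a)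

  _^L_ : Laur → ℕ → Laur
  x ^L zero  = 1L
  x ^L suc n = (x ^L n) *L x

  sumL : ℕ → (ℕ → Laur) → Laur
  sumL zero    f = 0L
  sumL (suc n) f = sumL n f +L f n

  indL : ∀ {a} {A : Set a} → Dec A → Laur → Laur
  indL (yes _) x = x
  indL (no _)  x = 0L

  -- Power series in one variable (z or u) over Laur: coefficient maps.
  PS : Set c
  PS = ℕ → Laur

  _≈PS_ : PS → PS → Set ℓ
  f ≈PS g = ∀ n → f n ≈L g n

  _*PS_ : PS → PS → PS
  (f *PS g) n = sumL (suc n) λ a → f a *L g (n ∸ a)

  -- Power series in two variables (z,t) over Laur:
  -- PS2 a b = coefficient of z^a t^b.
  PS2 : Set c
  PS2 = ℕ → ℕ → Laur

  one2 : PS2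
  one2 a b = indL (a ℕ.≟ 0) (indL (b ℕ.≟ 0) 1L)

  tSeries : PS2
  tSeries a b = indL (a ℕ.≟ 0) (indL (b ℕ.≟ 1) 1L)

  _*PS2_ : PS2 → PS2 → PS2
  (f *PS2 g) a b = sumL (suc a) λ i → sumL (suc b) λ j →
                     f i j *L g (a ∸ i) (b ∸ j)

  -- The Catalan power series  P(z,t) = t - t φ(t^(p-1) z),
  -- φ given by its coefficient sequence  φ = Σ_k φ k · X^k.
  catalanP : ℕ → (ℕ → Carrier) → PS2
  catalanP p φ a b =
    tSeries a b -L indL (b ℕ.≟ ((p ∸ 1) ℕ.* a ℕ.+ 1)) (embed (φ a))

  shiftP : ℕ → PS2 → PS2
  shiftP j P a b = qpow (+ (j ℕ.* a)) *L P a b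

  prodShiftP : PS2 → ℕ → PS2
  prodShiftP P zero    = one2
  prodShiftP P (suc k) = prodShiftP P k *PS2 shiftP k P

  -- predual basis  ẽ_(i₁,i₂)(z,t) = z^i₁ ∏_{0 ≤ j < i₂} P(q^j z, t)
  predual : PS2 → ℕ → ℕ → PS2
  predual P i₁ i₂ a b with a ℕ.<? i₁
  ... | yes _ = 0L
  ... | no  _ = prodShiftP P i₂ (a ∸ i₁) b

  -- T are the dual coefficients of P:  Σ_i T_i ẽ_i(z,t) = t.
  -- Coefficient of z^a t^b of the (infinite) sum; ẽ_(i₁,i₂) is divisible
  -- by z^i₁ t^i₂ (P is divisible by t), so only i₁ ≤ a, i₂ ≤ b contribute.
  IsDualCoeffs : PS2 → (ℕ → ℕ → Laur) → Set ℓ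
  IsDualCoeffs P T = ∀ a b →
    sumL (suc a) (λ i₁ → sumL (suc b) λ i₂ → T i₁ i₂ *L predual P i₁ i₂ a b)
      ≈L tSeries a b

  calT : ℕ → (ℕ → ℕ → Laur) → PS
  calT p T n = qpow (ℤ.- + ((p ∸ 1) ℕ.* (n C 2))) *L T n (n ℕ.* (p ∸ 1) ℕ.+ 1)

  phiFactor : (ℕ → Carrier) → ℕ → PS
  phiFactor φ n k =
    indL (k ℕ.≟ 0) 1L -L (embed (φ k) *L qpow (ℤ.- + (n ℕ.* k)))

  partialΦ : (ℕ → Carrier) → ℕ → PS
  partialΦ φ zero    k = indL (k ℕ.≟ 0) 1L
  partialΦ φ (suc N) = partialΦ φ N *PS phiFactor φ N

  -- Φ is the infinite product: coefficientwise (for each u^k q^e) the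
  -- partial products are eventually constant equal to Φ (formal limit).
  IsInfProdΦ : (ℕ → Carrier) → PS → Set ℓ
  IsInfProdΦ φ Φ = ∀ (k : ℕ) (e : ℤ) → ∃[ N ] (∀ M → N ℕ.≤ M →
                     lc (partialΦ φ M k) e ≈ lc (Φ k) e)

  -- A series in z, u, u⁻¹ of the form  Σ_n A n (z) u^(-n)  where A n is
  -- divisible by z^n, given by A : ℕ → PS (A n m = coeff of u^(-n) z^m).
  -- [u^0] (A · B) for a u-series B; the z^m coefficient is the sum over
  -- n ≤ m (terms with n > m vanish by divisibility).
  coeffU0 : (ℕ → PS) → PS → PS
  coeffU0 A B m = sumL (suc m) λ n → A n m *L B n

  -- θ(c·z/u, r) = Σ_n r^C(n,2) (c z/u)^n, as coefficients of u^(-n) z^m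
  thetaU : Laur → Laur → ℕ → PS
  thetaU c r n m = indL (m ℕ.≟ n) ((r ^L (n C 2)) *L (c ^L n))

module Submission where

-- Proposition 5.7.  Write κ = p - 1, F(u) = 1 - φ(u), Q_m(u) = ∏_{j<m} F(q^j u)
-- and T'_i = T_(i,iκ+1).
-- (1) P = t - tφ(t^κ z) has only the monomials F_a z^a t^(κa+1), hence
--     ∏_{j<m} P(q^j z,t) = Σ_a Q_m(a) z^a t^(m+κa), and the duality Σ_i T_i ẽ_i = t
--     read at z^a t^(κa+1) becomes  Σ_i T'_i z^i Q_(iκ+1)(z) = 1.
-- (2) Passing to the limit in the partial products gives Φ(u) = F(u) Φ(u/q), so
--     Φ(q^m u) = Q_(m+1)(u) Φ(u/q); multiplying (1) by Φ(z/q) gives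
--     Σ_i T'_i z^i Φ(q^(iκ) z) = Φ(z/q).
-- (3) [u^0] θ(cz/u, r) Φ(u) = Σ_N r^C(N,2) c^N Φ_N z^N, and C(N,2) = C(a,2) +
--     C(N-a,2) + a(N-a) turns the z^N-coefficient of the left side into q^(-κC(N,2))
--     times that of (2), which is the z^N-coefficient of the right side.

open import Level using (Level)
open import Algebra.Bundles using (CommutativeRing; CommutativeSemiring)

module FiniteSums {c ℓ : Level} (S : CommutativeSemiring c ℓ) where
  open import Data.Nat as ℕ using (ℕ; zero; suc; _∸_; _≤_; _<_; z≤n; s≤s; _≟_; _<?_)
  import Data.Nat.Properties as ℕP
  open import Relation.Nullary using (Dec; yes; no; ¬_)
  open import Relation.Nullary.Negation using (contradiction)
  open import Relation.Binary.PropositionalEquality as P using (_≡_; _≢_)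
  open CommutativeSemiring S
  open import Relation.Binary.Reasoning.Setoid setoid
  open import Algebra.Properties.CommutativeSemigroup +-commutativeSemigroup
    using () renaming (interchange to +-interchange)

  sum : ℕ → (ℕ → Carrier) → Carrier
  sum zero    f = 0#
  sum (suc n) f = sum n f + f n

  select : ∀ {a} {A : Set a} → Dec A → Carrier → Carrier
  select (yes _) r = r
  select (no _)  r = 0#

  select-yes : ∀ {a} {A : Set a} (d : Dec A) {r} → A → select d r ≈ r
  select-yes (yes _) _ = refl
  select-yes (no ¬p) p = contradiction p ¬p

  select-no : ∀ {a} {A : Set a} (d : Dec A) {r} → ¬ A → select d r ≈ 0#
  select-no (yes p) ¬p = contradiction p ¬p
  select-no (no _)  _  = refl

  select-cong : ∀ {a} {A : Set a} (d : Dec A) {r s} → r ≈ s → select d r ≈ select d s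
  select-cong (yes _) r≈s = r≈s
  select-cong (no _)  _   = refl

  select-*ˡ : ∀ {a} {A : Set a} (d : Dec A) r s → r * select d s ≈ select d (r * s)
  select-*ˡ (yes _) r s = refl
  select-*ˡ (no _)  r s = zeroʳ r

  sum-cong : ∀ n {f g : ℕ → Carrier} → (∀ i → i < n → f i ≈ g i) → sum n f ≈ sum n g
  sum-cong zero    h = refl
  sum-cong (suc n) h = +-cong (sum-cong n (λ i i<n → h i (ℕP.m<n⇒m<1+n i<n))) (h n ℕP.≤-refl)

  sum-cong-∀ : ∀ n {f g : ℕ → Carrier} → (∀ i → f i ≈ g i) → sum n f ≈ sum n g
  sum-cong-∀ n h = sum-cong n (λ i _ → h i)

  sum-zero : ∀ n {f : ℕ → Carrier} → (∀ i → i < n → f i ≈ 0#) → sum n f ≈ 0#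
  sum-zero zero    h = refl
  sum-zero (suc n) h =
    trans (+-cong (sum-zero n (λ i i<n → h i (ℕP.m<n⇒m<1+n i<n))) (h n ℕP.≤-refl)) (+-identityˡ 0#)

  sum-+ : ∀ n (f g : ℕ → Carrier) → sum n (λ i → f i + g i) ≈ sum n f + sum n g
  sum-+ zero    f g = sym (+-identityˡ 0#)
  sum-+ (suc n) f g = trans (+-congʳ (sum-+ n f g)) (+-interchange _ _ _ _)

  sum-*ˡ : ∀ n a (f : ℕ → Carrier) → a * sum n f ≈ sum n (λ i → a * f i)
  sum-*ˡ zero    a f = zeroʳ a
  sum-*ˡ (suc n) a f = trans (distribˡ a _ _) (+-congʳ (sum-*ˡ n a f))

  sum-*ʳ : ∀ n a (f : ℕ → Carrier) → sum n f * a ≈ sum n (λ i → f i * a)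
  sum-*ʳ zero    a f = zeroˡ a
  sum-*ʳ (suc n) a f = trans (distribʳ a _ _) (+-congʳ (sum-*ʳ n a f))

  sum-select : ∀ n {a} {A : Set a} (d : Dec A) (f : ℕ → Carrier) →
    sum n (λ i → select d (f i)) ≈ select d (sum n f)
  sum-select n (yes _) f = refl
  sum-select n (no _)  f = sum-zero n (λ _ _ → refl)

  sum-split : ∀ d L (f : ℕ → Carrier) → sum (d ℕ.+ L) f ≈ sum d f + sum L (λ b → f (d ℕ.+ b))
  sum-split d zero    f rewrite ℕP.+-identityʳ d = sym (+-identityʳ _)
  sum-split d (suc L) f rewrite ℕP.+-suc d L = trans (+-congʳ (sum-split d L f)) (+-assoc _ _ _)

  sum-single : ∀ n j {f : ℕ → Carrier} → j < n → (∀ i → i < n → i ≢ j → f i ≈ 0#) → sum n f ≈ f j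
  sum-single zero    j () h
  sum-single (suc n) j {f} j<1+n h with j ≟ n
  ... | yes P.refl =
    trans (+-congʳ (sum-zero n (λ i i<n → h i (ℕP.m<n⇒m<1+n i<n) (ℕP.<⇒≢ i<n)))) (+-identityˡ _)
  ... | no j≢n = trans (+-cong (sum-single n j (ℕP.≤∧≢⇒< (ℕP.≤-pred j<1+n) j≢n)
                                  (λ i i<n → h i (ℕP.m<n⇒m<1+n i<n)))
                               (h n ℕP.≤-refl (λ n≡j → j≢n (P.sym n≡j))))
                       (+-identityʳ _)

  sum-degrees : ∀ b j₀ r x y →
    sum (suc b) (λ j → select (j ≟ j₀) x * select (b ∸ j ≟ r) y) ≈ select (b ≟ j₀ ℕ.+ r) (x * y)
  sum-degrees b j₀ r x y with b ≟ j₀ ℕ.+ r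
  ... | yes P.refl = trans (sum-single (suc b) j₀ (s≤s (ℕP.m≤m+n j₀ r)) off)
                           (*-cong (select-yes (j₀ ≟ j₀) P.refl) (select-yes (j₀ ℕ.+ r ∸ j₀ ≟ r) (ℕP.m+n∸m≡n j₀ r)))
    where
    off : ∀ j → j < suc (j₀ ℕ.+ r) → j ≢ j₀ → select (j ≟ j₀) x * select (j₀ ℕ.+ r ∸ j ≟ r) y ≈ 0#
    off j _ j≢j₀ = trans (*-congʳ (select-no (j ≟ j₀) j≢j₀)) (zeroˡ _)
  ... | no b≢j₀+r = sum-zero (suc b) vanish
    where
    vanish : ∀ j → j < suc b → select (j ≟ j₀) x * select (b ∸ j ≟ r) y ≈ 0#
    vanish j j≤b with j ≟ j₀
    ... | no _ = zeroˡ _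
    ... | yes P.refl = trans (*-congˡ (select-no (b ∸ j ≟ r) (λ b∸j≡r →
                         b≢j₀+r (P.trans (P.sym (ℕP.m+[n∸m]≡n (ℕP.≤-pred j≤b))) (P.cong (j ℕ.+_) b∸j≡r)))))
                             (zeroʳ _)

  sum-select-index : ∀ b j₀ s (f g : ℕ → Carrier) → b ≡ j₀ ℕ.+ s →
    sum (suc b) (λ j → f j * select (b ≟ j ℕ.+ s) (g j)) ≈ f j₀ * g j₀
  sum-select-index b j₀ s f g b≡j₀+s =
    trans (sum-single (suc b) j₀ (s≤s (P.subst (j₀ ≤_) (P.sym b≡j₀+s) (ℕP.m≤m+n j₀ s))) off)
          (*-congˡ (select-yes (b ≟ j₀ ℕ.+ s) b≡j₀+s))
    where
    off : ∀ j → j < suc b → j ≢ j₀ → f j * select (b ≟ j ℕ.+ s) (g j) ≈ 0#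
    off j _ j≢j₀ = trans (*-congˡ (select-no (b ≟ j ℕ.+ s) (λ b≡j+s →
                     j≢j₀ (ℕP.+-cancelʳ-≡ s j j₀ (P.trans (P.sym b≡j+s) b≡j₀+s))))) (zeroʳ _)

  sum-swap : ∀ n m (f : ℕ → ℕ → Carrier) →
    sum n (λ i → sum m (λ j → f i j)) ≈ sum m (λ j → sum n (λ i → f i j))
  sum-swap zero    m f = sym (sum-zero m (λ _ _ → refl))
  sum-swap (suc n) m f = trans (+-congʳ (sum-swap n m f)) (sym (sum-+ m _ _))

  sum-reverse : ∀ N (f : ℕ → Carrier) → sum (suc N) f ≈ sum (suc N) (λ i → f (N ∸ i))
  sum-reverse zero    f = refl
  sum-reverse (suc N) f = begin
    sum (suc N) f + f (suc N)                  ≈⟨ +-congʳ (sum-reverse N f) ⟩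
    sum (suc N) (λ i → f (N ∸ i)) + f (suc N)  ≈⟨ +-comm _ _ ⟩
    f (suc N) + sum (suc N) (λ i → f (N ∸ i))  ≈⟨ +-congʳ (sym (+-identityˡ _)) ⟩
    (0# + f (suc N)) + sum (suc N) (λ i → f (N ∸ i))
      ≈⟨ sym (sum-split 1 (suc N) (λ i → f (suc N ∸ i))) ⟩
    sum (suc (suc N)) (λ i → f (suc N ∸ i))    ∎

  sum-upTo : ∀ n M (g : ℕ → Carrier) → n ≤ M → sum M (λ i → select (i <? n) (g i)) ≈ sum n g
  sum-upTo n M g n≤M = begin
    sum M h                                ≡⟨ P.cong (λ k → sum k h) (P.sym (ℕP.m+[n∸m]≡n n≤M)) ⟩
    sum (n ℕ.+ (M ∸ n)) h                  ≈⟨ sum-split n (M ∸ n) h ⟩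
    sum n h + sum (M ∸ n) (λ b → h (n ℕ.+ b))
      ≈⟨ +-cong (sum-cong n (λ i i<n → select-yes (i <? n) i<n))
                (sum-zero (M ∸ n) (λ b _ → select-no (n ℕ.+ b <? n) (ℕP.m+n≮m n b))) ⟩
    sum n g + 0#                           ≈⟨ +-identityʳ _ ⟩
    sum n g                                ∎
    where
    h : ℕ → Carrier
    h i = select (i <? n) (g i)

  sum-from : ∀ N i (g : ℕ → Carrier) → i ≤ N →
    sum (suc N) (λ n → select (i <? suc n) (g n)) ≈ sum (suc (N ∸ i)) (λ k → g (i ℕ.+ k))
  sum-from N i g i≤N = begin
    sum (suc N) h                          ≡⟨ P.cong (λ n → sum n h) (P.sym length) ⟩
    sum (i ℕ.+ suc (N ∸ i)) h              ≈⟨ sum-split i (suc (N ∸ i)) h ⟩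
    sum i h + sum (suc (N ∸ i)) (λ k → h (i ℕ.+ k))
      ≈⟨ +-cong (sum-zero i (λ n n<i → select-no (i <? suc n) (λ i≤n → ℕP.<⇒≱ n<i (ℕP.≤-pred i≤n))))
                (sum-cong-∀ (suc (N ∸ i)) (λ k → select-yes (i <? suc (i ℕ.+ k)) (s≤s (ℕP.m≤m+n i k)))) ⟩
    0# + sum (suc (N ∸ i)) (λ k → g (i ℕ.+ k)) ≈⟨ +-identityˡ _ ⟩
    sum (suc (N ∸ i)) (λ k → g (i ℕ.+ k)) ∎
    where
    h : ℕ → Carrier
    h n = select (i <? suc n) (g n)
    length : i ℕ.+ suc (N ∸ i) ≡ suc N
    length = P.trans (ℕP.+-suc i (N ∸ i)) (P.cong suc (ℕP.m+[n∸m]≡n i≤N))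

  sum-triangle : ∀ N (h : ℕ → ℕ → ℕ → Carrier) →
    sum (suc N) (λ n → sum (suc n) (λ i → h i (n ∸ i) (N ∸ n))) ≈
    sum (suc N) (λ i → sum (suc (N ∸ i)) (λ k → h i k (N ∸ i ∸ k)))
  sum-triangle N h = begin
    sum (suc N) (λ n → sum (suc n) (λ i → h i (n ∸ i) (N ∸ n)))
      ≈⟨ sum-cong (suc N) (λ n n≤N → sym (sum-upTo (suc n) (suc N) _ n≤N)) ⟩
    sum (suc N) (λ n → sum (suc N) (λ i → select (i <? suc n) (h i (n ∸ i) (N ∸ n))))
      ≈⟨ sum-swap (suc N) (suc N) _ ⟩
    sum (suc N) (λ i → sum (suc N) (λ n → select (i <? suc n) (h i (n ∸ i) (N ∸ n))))
      ≈⟨ sum-cong (suc N) (λ i i≤N → sum-from N i _ (ℕP.≤-pred i≤N)) ⟩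
    sum (suc N) (λ i → sum (suc (N ∸ i)) (λ k → h i (i ℕ.+ k ∸ i) (N ∸ (i ℕ.+ k))))
      ≈⟨ sum-cong-∀ (suc N) (λ i → sum-cong-∀ (suc (N ∸ i)) (λ k →
           reflexive (P.cong₂ (h i) (ℕP.m+n∸m≡n i k) (P.sym (ℕP.∸-+-assoc N i k))))) ⟩
    sum (suc N) (λ i → sum (suc (N ∸ i)) (λ k → h i k (N ∸ i ∸ k))) ∎

  -- Coefficient sequences of power series.  zSum c A is the series Σ_i c_i z^i A_i(z);
  -- the Cauchy product is its special case with A constant.
  zSum : (ℕ → Carrier) → (ℕ → ℕ → Carrier) → ℕ → Carrier
  zSum c A n = sum (suc n) (λ i → c i * A i (n ∸ i))

  conv : (ℕ → Carrier) → (ℕ → Carrier) → ℕ → Carrier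
  conv f g = zSum f (λ _ → g)

  one : ℕ → Carrier
  one k = select (k ≟ 0) 1#

  zSum-conv : ∀ c A B n → conv (zSum c A) B n ≈ zSum c (λ i → conv (A i) B) n
  zSum-conv c A B n = begin
    sum (suc n) (λ m → sum (suc m) (λ i → c i * A i (m ∸ i)) * B (n ∸ m))
      ≈⟨ sum-cong-∀ (suc n) (λ m → sum-*ʳ (suc m) (B (n ∸ m)) _) ⟩
    sum (suc n) (λ m → sum (suc m) (λ i → (c i * A i (m ∸ i)) * B (n ∸ m)))
      ≈⟨ sum-cong-∀ (suc n) (λ m → sum-cong-∀ (suc m) (λ i → *-assoc _ _ _)) ⟩
    sum (suc n) (λ m → sum (suc m) (λ i → term i (m ∸ i) (n ∸ m)))
      ≈⟨ sum-triangle n term ⟩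
    sum (suc n) (λ i → sum (suc (n ∸ i)) (λ k → term i k (n ∸ i ∸ k)))
      ≈⟨ sum-cong-∀ (suc n) (λ i → sym (sum-*ˡ (suc (n ∸ i)) (c i) _)) ⟩
    zSum c (λ i → conv (A i) B) n ∎
    where
    term : ℕ → ℕ → ℕ → Carrier
    term i k l = c i * (A i k * B l)

  zSum-cong : ∀ c {A A′ : ℕ → ℕ → Carrier} → (∀ i k → A i k ≈ A′ i k) → ∀ n → zSum c A n ≈ zSum c A′ n
  zSum-cong c h n = sum-cong-∀ (suc n) (λ i → *-congˡ (h i (n ∸ i)))

  conv-cong : ∀ {f f′ g g′ : ℕ → Carrier} → (∀ i → f i ≈ f′ i) → (∀ i → g i ≈ g′ i) →
    ∀ n → conv f g n ≈ conv f′ g′ n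
  conv-cong hf hg n = sum-cong-∀ (suc n) (λ a → *-cong (hf a) (hg (n ∸ a)))

  conv-congˡ : ∀ {f f′ : ℕ → Carrier} g → (∀ i → f i ≈ f′ i) → ∀ n → conv f g n ≈ conv f′ g n
  conv-congˡ g hf = conv-cong {g = g} {g′ = g} hf (λ _ → refl)

  conv-congʳ : ∀ f {g g′ : ℕ → Carrier} → (∀ i → g i ≈ g′ i) → ∀ n → conv f g n ≈ conv f g′ n
  conv-congʳ f hg = conv-cong {f = f} {f′ = f} (λ _ → refl) hg

  conv-comm : ∀ f g n → conv f g n ≈ conv g f n
  conv-comm f g n = trans (sum-reverse n _) (sum-cong (suc n) (λ a a≤n →
    trans (*-comm _ _) (*-congʳ (reflexive (P.cong g (ℕP.m∸[m∸n]≡n (ℕP.≤-pred a≤n)))))))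

  conv-assoc : ∀ f g h n → conv f (conv g h) n ≈ conv (conv f g) h n
  conv-assoc f g h n = sym (zSum-conv f (λ _ → g) h n)

  conv-distribˡ : ∀ f g h n → conv f (λ i → g i + h i) n ≈ conv f g n + conv f h n
  conv-distribˡ f g h n = trans (sum-cong-∀ (suc n) (λ a → distribˡ _ _ _)) (sum-+ (suc n) _ _)

  conv-identityˡ : ∀ f n → conv one f n ≈ f n
  conv-identityˡ f n = trans (sum-single (suc n) 0 (s≤s z≤n) off) (*-identityˡ _)
    where
    off : ∀ i → i < suc n → i ≢ 0 → one i * f (n ∸ i) ≈ 0#
    off i _ i≢0 = trans (*-congʳ (select-no (i ≟ 0) i≢0)) (zeroˡ _)

  conv-identityʳ : ∀ f n → conv f one n ≈ f n
  conv-identityʳ f n = trans (conv-comm f one n) (conv-identityˡ f n)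

module Offsets where
  open import Data.Nat as ℕ using (ℕ; zero; suc)
  open import Data.Integer as ℤ using (ℤ; +_; -[1+_]; _⊖_)
  import Data.Integer.Properties as ℤP
  import Data.Nat.Properties as ℕP
  open import Data.Integer.Tactic.RingSolver using (solve-∀)
  open import Data.Product using (∃; _,_)
  open import Data.Sum using (_⊎_; inj₁; inj₂)
  open import Relation.Binary.PropositionalEquality as P using (_≡_)

  ≤⇒offset : ∀ {i j : ℤ} → i ℤ.≤ j → j ≡ i ℤ.+ + ℤ.∣ j ℤ.- i ∣
  ≤⇒offset {i} {j} i≤j =
    P.trans (split j i) (P.cong (λ z → i ℤ.+ z) (P.sym (ℤP.0≤i⇒+∣i∣≡i (ℤP.i≤j⇒0≤j-i i≤j))))
    where
    split : ∀ (j i : ℤ) → j ≡ i ℤ.+ (j ℤ.- i)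
    split = solve-∀

  ⊔-offsetˡ : ∀ i j → ∃ λ d → i ℤ.⊔ j ≡ i ℤ.+ + d
  ⊔-offsetˡ i j = _ , ≤⇒offset (ℤP.i≤i⊔j i j)

  ⊔-offsetʳ : ∀ i j → ∃ λ d → i ℤ.⊔ j ≡ j ℤ.+ + d
  ⊔-offsetʳ i j = _ , P.trans (ℤP.⊔-comm i j) (≤⇒offset (ℤP.i≤i⊔j j i))

  below⊎above : ∀ (A e : ℤ) → (∃ λ i → e ≡ A ℤ.- + i) ⊎ (∃ λ k → e ≡ A ℤ.+ + suc k)
  below⊎above A e with e ℤ.- A | split A e
    where
    split : ∀ (A e : ℤ) → e ≡ A ℤ.+ (e ℤ.- A)
    split = solve-∀
  ... | + zero   | e≡A+0 = inj₁ (0 , e≡A+0)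
  ... | + suc k  | e≡A+k = inj₂ (k , e≡A+k)
  ... | -[1+ n ] | e≡A-n = inj₁ (suc n , e≡A-n)

  gap-below : ∀ (t : ℤ) d i → t ℤ.- ((t ℤ.+ + d) ℤ.- + i) ≡ i ⊖ d
  gap-below t d i = P.trans (lemma t (+ d) (+ i)) (ℤP.[+m]-[+n]≡m⊖n i d)
    where
    lemma : ∀ (t d i : ℤ) → t ℤ.- ((t ℤ.+ d) ℤ.- i) ≡ i ℤ.- d
    lemma = solve-∀

  gap-above : ∀ (t : ℤ) d k → t ℤ.- ((t ℤ.+ + d) ℤ.+ + suc k) ≡ -[1+ (d ℕ.+ k) ]
  gap-above t d k = P.trans (lemma t (+ d) (+ suc k))
    (P.cong ℤ.-_ (P.trans (P.sym (ℤP.pos-+ d (suc k))) (P.cong +_ (ℕP.+-suc d k))))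
    where
    lemma : ∀ (t d i : ℤ) → t ℤ.- ((t ℤ.+ d) ℤ.+ i) ≡ ℤ.- (d ℤ.+ i)
    lemma = solve-∀

  gap-above-top : ∀ (t : ℤ) k → t ℤ.- (t ℤ.+ + suc k) ≡ -[1+ k ]
  gap-above-top t k = lemma t (+ suc k)
    where
    lemma : ∀ (t i : ℤ) → t ℤ.- (t ℤ.+ i) ≡ ℤ.- i
    lemma = solve-∀

  offset-+ : ∀ {A B : ℤ} (tx ty : ℤ) (dx dy : ℕ) → A ≡ tx ℤ.+ + dx → B ≡ ty ℤ.+ + dy →
    A ℤ.+ B ≡ (tx ℤ.+ ty) ℤ.+ + (dx ℕ.+ dy)
  offset-+ tx ty dx dy P.refl P.refl =
    P.trans (lemma tx ty (+ dx) (+ dy)) (P.cong (λ z → (tx ℤ.+ ty) ℤ.+ z) (P.sym (ℤP.pos-+ dx dy)))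
    where
    lemma : ∀ (a b c d : ℤ) → (a ℤ.+ c) ℤ.+ (b ℤ.+ d) ≡ (a ℤ.+ b) ℤ.+ (c ℤ.+ d)
    lemma = solve-∀

-- A series x is
-- compared with another through a common upper bound A = top x + d of their
-- exponents: below A its coefficients are cf x delayed by d, above A they vanish.
module Laurent {c ℓ : Level} (R : CommutativeRing c ℓ) where
  open import Data.Nat as ℕ using (ℕ; zero; suc; _∸_; _≤_; _<_; z≤n; s≤s; _<?_)
  import Data.Nat.Properties as ℕP
  open import Data.Integer as ℤ using (ℤ; +_; -[1+_]; _⊖_)
  import Data.Integer.Properties as ℤP
  open import Data.Integer.Tactic.RingSolver using (solve-∀)
  open import Data.Product using (_,_)
  open import Data.Sum using (inj₁; inj₂)
  open import Relation.Nullary using (yes; no)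
  open import Relation.Nullary.Negation using (contradiction)
  open import Relation.Binary.PropositionalEquality as P using (_≡_; _≢_)
  open import Data.Sign using (Sign)
  open import Defs
  open Offsets
  open CommutativeRing R
  open Series R
  open FiniteSums commutativeSemiring
  open import Relation.Binary.Reasoning.Setoid setoid
  open import Algebra.Properties.Ring ring using (-0#≈0#)

  coefAt-cong : ∀ z {f g : ℕ → Carrier} → (∀ k → f k ≈ g k) → coefAt z f ≈ coefAt z g
  coefAt-cong (+ k)    h = h k
  coefAt-cong -[1+ _ ] h = refl

  coefAt-negative : ∀ z (f : ℕ → Carrier) → ℤ.sign z ≡ Sign.- → coefAt z f ≈ 0#
  coefAt-negative -[1+ _ ] f _ = refl
  coefAt-negative (+ zero)  f ()
  coefAt-negative (+ suc _) f ()

  delay : ℕ → (ℕ → Carrier) → ℕ → Carrier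
  delay d f a = coefAt (a ⊖ d) f

  delay-below : ∀ {a d} f → a < d → delay d f a ≈ 0#
  delay-below f a<d = coefAt-negative _ f (ℤP.sign-⊖-< a<d)

  delay-above : ∀ {a d} f → d ≤ a → delay d f a ≡ f (a ∸ d)
  delay-above f d≤a = P.cong (λ z → coefAt z f) (ℤP.⊖-≥ d≤a)

  delay-zero : ∀ f a → delay 0 f a ≡ f a
  delay-zero f a = delay-above f z≤n

  delay-delay : ∀ dx dy h i → delay dx (delay dy h) i ≈ delay (dx ℕ.+ dy) h i
  delay-delay dx dy h i with i <? dx
  ... | yes i<dx = trans (delay-below _ i<dx)
                         (sym (delay-below h (ℕP.<-≤-trans i<dx (ℕP.m≤m+n dx dy))))
  ... | no i≮dx = reflexive (P.trans (delay-above _ dx≤i) (P.cong (λ z → coefAt z h) exponent))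
    where
    dx≤i : dx ≤ i
    dx≤i = ℕP.≮⇒≥ i≮dx
    exponent : (i ∸ dx) ⊖ dy ≡ i ⊖ (dx ℕ.+ dy)
    exponent = P.trans (P.sym (ℤP.+-cancelˡ-⊖ dx (i ∸ dx) dy))
                       (P.cong (_⊖ (dx ℕ.+ dy)) (ℕP.m+[n∸m]≡n dx≤i))

  delay-conv : ∀ d f g n → conv (delay d f) g n ≈ delay d (conv f g) n
  delay-conv d f g n with n <? d
  ... | yes n<d = trans (sum-zero (suc n) (λ a a≤n →
                           trans (*-congʳ (delay-below f (ℕP.<-≤-trans a≤n n<d))) (zeroˡ _)))
                        (sym (delay-below _ n<d))
  ... | no n≮d = begin
    sum (suc n) h                          ≡⟨ P.cong (λ k → sum k h) (P.sym length) ⟩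
    sum (d ℕ.+ suc (n ∸ d)) h              ≈⟨ sum-split d (suc (n ∸ d)) h ⟩
    sum d h + sum (suc (n ∸ d)) (λ b → h (d ℕ.+ b))
      ≈⟨ +-cong (sum-zero d (λ a a<d → trans (*-congʳ (delay-below f a<d)) (zeroˡ _)))
                (sum-cong-∀ (suc (n ∸ d)) shifted-term) ⟩
    0# + conv f g (n ∸ d)                  ≈⟨ +-identityˡ _ ⟩
    conv f g (n ∸ d)                       ≡⟨ P.sym (delay-above (conv f g) d≤n) ⟩
    delay d (conv f g) n                   ∎
    where
    h : ℕ → Carrier
    h a = delay d f a * g (n ∸ a)
    d≤n : d ≤ n
    d≤n = ℕP.≮⇒≥ n≮d
    length : d ℕ.+ suc (n ∸ d) ≡ suc n
    length = P.trans (ℕP.+-suc d (n ∸ d)) (P.cong suc (ℕP.m+[n∸m]≡n d≤n))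
    shifted-term : ∀ b → h (d ℕ.+ b) ≈ f b * g (n ∸ d ∸ b)
    shifted-term b = *-cong (reflexive (P.trans (delay-above f (ℕP.m≤m+n d b))
                                                (P.cong f (ℕP.m+n∸m≡n d b))))
                            (reflexive (P.cong g (P.sym (ℕP.∸-+-assoc n d b))))

  conv-delay : ∀ dx dy f g i → conv (delay dx f) (delay dy g) i ≈ delay (dx ℕ.+ dy) (conv f g) i
  conv-delay dx dy f g i = begin
    conv (delay dx f) (delay dy g) i  ≈⟨ delay-conv dx f (delay dy g) i ⟩
    delay dx (conv f (delay dy g)) i  ≈⟨ coefAt-cong (i ⊖ dx) inner ⟩
    delay dx (delay dy (conv f g)) i  ≈⟨ delay-delay dx dy _ i ⟩
    delay (dx ℕ.+ dy) (conv f g) i    ∎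
    where
    inner : ∀ k → conv f (delay dy g) k ≈ delay dy (conv f g) k
    inner k = trans (conv-comm f (delay dy g) k)
                    (trans (delay-conv dy g f k) (coefAt-cong (k ⊖ dy) (conv-comm g f)))

  sumR≡sum : ∀ n f → sumR n f ≡ sum n f
  sumR≡sum zero    f = P.refl
  sumR≡sum (suc n) f = P.cong (_+ f n) (sumR≡sum n f)

  cf-* : ∀ x y m → cf (x *L y) m ≈ conv (cf x) (cf y) m
  cf-* x y m = reflexive (sumR≡sum (suc m) _)

  lc-below : ∀ x A d i → A ≡ top x ℤ.+ + d → lc x (A ℤ.- + i) ≡ delay d (cf x) i
  lc-below x A d i P.refl = P.cong (λ z → coefAt z (cf x)) (gap-below (top x) d i)

  lc-above : ∀ x A d k → A ≡ top x ℤ.+ + d → lc x (A ℤ.+ + suc k) ≈ 0#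
  lc-above x A d k P.refl rewrite gap-above (top x) d k = refl

  ≈L-below : ∀ x y A dx dy → A ≡ top x ℤ.+ + dx → A ≡ top y ℤ.+ + dy →
    (∀ i → lc x (A ℤ.- + i) ≈ lc y (A ℤ.- + i)) → x ≈L y
  ≈L-below x y A dx dy ex ey h e with below⊎above A e
  ... | inj₁ (i , P.refl) = h i
  ... | inj₂ (k , P.refl) = trans (lc-above x A dx k ex) (sym (lc-above y A dy k ey))

  ≈L⇒delay : ∀ x y A dx dy → A ≡ top x ℤ.+ + dx → A ≡ top y ℤ.+ + dy → x ≈L y →
    ∀ i → delay dx (cf x) i ≈ delay dy (cf y) i
  ≈L⇒delay x y A dx dy ex ey h i =
    trans (reflexive (P.sym (lc-below x A dx i ex))) (trans (h _) (reflexive (lc-below y A dy i ey)))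

  ≈L-cf : ∀ x y → top x ≡ top y → (∀ k → cf x k ≈ cf y k) → x ≈L y
  ≈L-cf x y eq h e rewrite eq = coefAt-cong (top y ℤ.- e) h

  lc-*-below : ∀ x y A dx B dy i → A ≡ top x ℤ.+ + dx → B ≡ top y ℤ.+ + dy →
    lc (x *L y) ((A ℤ.+ B) ℤ.- + i) ≈ conv (delay dx (cf x)) (delay dy (cf y)) i
  lc-*-below x y A dx B dy i ex ey = begin
    lc (x *L y) ((A ℤ.+ B) ℤ.- + i)
      ≡⟨ lc-below (x *L y) (A ℤ.+ B) (dx ℕ.+ dy) i (offset-+ (top x) (top y) dx dy ex ey) ⟩
    delay (dx ℕ.+ dy) (cf (x *L y)) i          ≈⟨ coefAt-cong (i ⊖ (dx ℕ.+ dy)) (cf-* x y) ⟩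
    delay (dx ℕ.+ dy) (conv (cf x) (cf y)) i   ≈⟨ sym (conv-delay dx dy (cf x) (cf y) i) ⟩
    conv (delay dx (cf x)) (delay dy (cf y)) i ∎

  lc-*-above : ∀ x y A dx B dy k → A ≡ top x ℤ.+ + dx → B ≡ top y ℤ.+ + dy →
    lc (x *L y) ((A ℤ.+ B) ℤ.+ + suc k) ≈ 0#
  lc-*-above x y A dx B dy k ex ey =
    lc-above (x *L y) (A ℤ.+ B) (dx ℕ.+ dy) k (offset-+ (top x) (top y) dx dy ex ey)

  lc-+ : ∀ x y e → lc (x +L y) e ≈ lc x e + lc y e
  lc-+ x y e with ⊔-offsetˡ (top x) (top y) | ⊔-offsetʳ (top x) (top y) | below⊎above (top x ℤ.⊔ top y) e
  ... | _ | _ | inj₁ (i , P.refl) =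
    reflexive (P.cong (λ z → coefAt z (cf (x +L y))) (gap (top x ℤ.⊔ top y) (+ i)))
    where
    gap : ∀ (t i : ℤ) → t ℤ.- (t ℤ.- i) ≡ i
    gap = solve-∀
  ... | dx , ex | dy , ey | inj₂ (k , P.refl) rewrite gap-above-top (top x ℤ.⊔ top y) k =
    trans (sym (+-identityˡ 0#)) (sym (+-cong (lc-above x _ dx k ex) (lc-above y _ dy k ey)))

  lc-neg : ∀ x e → lc (-L x) e ≈ - lc x e
  lc-neg x e = negate (top x ℤ.- e)
    where
    negate : ∀ z → coefAt z (λ m → - cf x m) ≈ - coefAt z (cf x)
    negate (+ k)    = refl
    negate -[1+ _ ] = sym -0#≈0#

  lc-0 : ∀ e → lc 0L e ≈ 0#
  lc-0 e with + 0 ℤ.- e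
  ... | + zero   = refl
  ... | + suc _  = refl
  ... | -[1+ _ ] = refl

  cf-1 : ∀ k → cf 1L k ≈ one k
  cf-1 zero    = refl
  cf-1 (suc k) = refl

  ≈L-refl : ∀ {x} → x ≈L x
  ≈L-refl e = refl

  ≈L-sym : ∀ {x y} → x ≈L y → y ≈L x
  ≈L-sym h e = sym (h e)

  ≈L-trans : ∀ x y z → x ≈L y → y ≈L z → x ≈L z
  ≈L-trans x y z h g e = trans (h e) (g e)

  +L-cong : ∀ x x′ y y′ → x ≈L x′ → y ≈L y′ → (x +L y) ≈L (x′ +L y′)
  +L-cong x x′ y y′ h g e = trans (lc-+ x y e) (trans (+-cong (h e) (g e)) (sym (lc-+ x′ y′ e)))

  +L-assoc : ∀ x y z → ((x +L y) +L z) ≈L (x +L (y +L z))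
  +L-assoc x y z e = begin
    lc ((x +L y) +L z) e        ≈⟨ trans (lc-+ (x +L y) z e) (+-congʳ (lc-+ x y e)) ⟩
    (lc x e + lc y e) + lc z e  ≈⟨ +-assoc _ _ _ ⟩
    lc x e + (lc y e + lc z e)  ≈⟨ sym (trans (lc-+ x (y +L z) e) (+-congˡ (lc-+ y z e))) ⟩
    lc (x +L (y +L z)) e        ∎

  +L-comm : ∀ x y → (x +L y) ≈L (y +L x)
  +L-comm x y e = trans (lc-+ x y e) (trans (+-comm _ _) (sym (lc-+ y x e)))

  +L-identityˡ : ∀ x → (0L +L x) ≈L x
  +L-identityˡ x e = trans (lc-+ 0L x e) (trans (+-congʳ (lc-0 e)) (+-identityˡ _))

  +L-identityʳ : ∀ x → (x +L 0L) ≈L x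
  +L-identityʳ x = ≈L-trans (x +L 0L) (0L +L x) x (+L-comm x 0L) (+L-identityˡ x)

  -L-inverseˡ : ∀ x → ((-L x) +L x) ≈L 0L
  -L-inverseˡ x e =
    trans (lc-+ (-L x) x e) (trans (+-congʳ (lc-neg x e)) (trans (-‿inverseˡ _) (sym (lc-0 e))))

  -L-inverseʳ : ∀ x → (x +L (-L x)) ≈L 0L
  -L-inverseʳ x = ≈L-trans (x +L (-L x)) ((-L x) +L x) 0L (+L-comm x (-L x)) (-L-inverseˡ x)

  -L-cong : ∀ x y → x ≈L y → (-L x) ≈L (-L y)
  -L-cong x y h e = trans (lc-neg x e) (trans (-‿cong (h e)) (sym (lc-neg y e)))

  *L-comm : ∀ x y → (x *L y) ≈L (y *L x)
  *L-comm x y = ≈L-cf (x *L y) (y *L x) (ℤP.+-comm (top x) (top y))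
    (λ k → trans (cf-* x y k) (trans (conv-comm (cf x) (cf y) k) (sym (cf-* y x k))))

  *L-assoc : ∀ x y z → ((x *L y) *L z) ≈L (x *L (y *L z))
  *L-assoc x y z = ≈L-cf ((x *L y) *L z) (x *L (y *L z)) (ℤP.+-assoc (top x) (top y) (top z)) λ k → begin
    cf ((x *L y) *L z) k                ≈⟨ cf-* (x *L y) z k ⟩
    conv (cf (x *L y)) (cf z) k         ≈⟨ conv-congˡ (cf z) (cf-* x y) k ⟩
    conv (conv (cf x) (cf y)) (cf z) k  ≈⟨ sym (conv-assoc (cf x) (cf y) (cf z) k) ⟩
    conv (cf x) (conv (cf y) (cf z)) k  ≈⟨ sym (conv-congʳ (cf x) (cf-* y z) k) ⟩
    conv (cf x) (cf (y *L z)) k         ≈⟨ sym (cf-* x (y *L z) k) ⟩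
    cf (x *L (y *L z)) k                ∎

  *L-identityˡ : ∀ x → (1L *L x) ≈L x
  *L-identityˡ x = ≈L-cf (1L *L x) x (ℤP.+-identityˡ (top x)) λ k →
    trans (cf-* 1L x k) (trans (conv-congˡ (cf x) cf-1 k) (conv-identityˡ (cf x) k))

  *L-identityʳ : ∀ x → (x *L 1L) ≈L x
  *L-identityʳ x = ≈L-trans (x *L 1L) (1L *L x) x (*L-comm x 1L) (*L-identityˡ x)

  -- Congruence needs the bound argument: equal series may have different tops.
  *L-congʳ : ∀ x x′ y → x ≈L x′ → (x *L y) ≈L (x′ *L y)
  *L-congʳ x x′ y h with ⊔-offsetˡ (top x) (top x′) | ⊔-offsetʳ (top x) (top x′)
  ... | dx , ex | dx′ , ex′ =
    ≈L-below (x *L y) (x′ *L y) ((top x ℤ.⊔ top x′) ℤ.+ (top y ℤ.+ + 0)) (dx ℕ.+ 0) (dx′ ℕ.+ 0)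
      (offset-+ (top x) (top y) dx 0 ex P.refl) (offset-+ (top x′) (top y) dx′ 0 ex′ P.refl) λ i → begin
      lc (x *L y) _                          ≈⟨ lc-*-below x y _ dx _ 0 i ex P.refl ⟩
      conv (delay dx (cf x)) (delay 0 (cf y)) i
        ≈⟨ conv-congˡ (delay 0 (cf y)) (≈L⇒delay x x′ _ dx dx′ ex ex′ h) i ⟩
      conv (delay dx′ (cf x′)) (delay 0 (cf y)) i ≈⟨ sym (lc-*-below x′ y _ dx′ _ 0 i ex′ P.refl) ⟩
      lc (x′ *L y) _                         ∎

  *L-cong : ∀ x x′ y y′ → x ≈L x′ → y ≈L y′ → (x *L y) ≈L (x′ *L y′)
  *L-cong x x′ y y′ h g =
    ≈L-trans (x *L y) (x′ *L y) (x′ *L y′) (*L-congʳ x x′ y h)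
      (≈L-trans (x′ *L y) (y *L x′) (x′ *L y′) (*L-comm x′ y)
        (≈L-trans (y *L x′) (y′ *L x′) (x′ *L y′) (*L-congʳ y y′ x′ g) (*L-comm y′ x′)))

  *L-distribˡ : ∀ x y z → (x *L (y +L z)) ≈L ((x *L y) +L (x *L z))
  *L-distribˡ x y z e with ⊔-offsetˡ (top y) (top z) | ⊔-offsetʳ (top y) (top z)
  ... | dy , ey | dz , ez = trans (distributed e) (sym (lc-+ (x *L y) (x *L z) e))
    where
    t = top y ℤ.⊔ top z
    A = top x ℤ.+ + 0
    et : t ≡ top (y +L z) ℤ.+ + 0
    et = P.sym (ℤP.+-identityʳ t)
    distributed : ∀ e → lc (x *L (y +L z)) e ≈ lc (x *L y) e + lc (x *L z) e
    distributed e with below⊎above (A ℤ.+ t) e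
    ... | inj₁ (i , P.refl) = begin
      lc (x *L (y +L z)) ((A ℤ.+ t) ℤ.- + i)   ≈⟨ lc-*-below x (y +L z) A 0 t 0 i P.refl et ⟩
      conv (delay 0 (cf x)) (delay 0 (cf (y +L z))) i
        ≈⟨ conv-congʳ (delay 0 (cf x)) (λ k → reflexive (P.trans (delay-zero (cf (y +L z)) k)
             (P.cong₂ _+_ (lc-below y t dy k ey) (lc-below z t dz k ez)))) i ⟩
      conv (delay 0 (cf x)) (λ k → delay dy (cf y) k + delay dz (cf z) k) i
        ≈⟨ conv-distribˡ (delay 0 (cf x)) (delay dy (cf y)) (delay dz (cf z)) i ⟩
      conv (delay 0 (cf x)) (delay dy (cf y)) i + conv (delay 0 (cf x)) (delay dz (cf z)) i
        ≈⟨ sym (+-cong (lc-*-below x y A 0 t dy i P.refl ey) (lc-*-below x z A 0 t dz i P.refl ez)) ⟩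
      lc (x *L y) ((A ℤ.+ t) ℤ.- + i) + lc (x *L z) ((A ℤ.+ t) ℤ.- + i) ∎
    ... | inj₂ (k , P.refl) =
      trans (lc-*-above x (y +L z) A 0 t 0 k P.refl et)
            (sym (trans (+-cong (lc-*-above x y A 0 t dy k P.refl ey) (lc-*-above x z A 0 t dz k P.refl ez))
                        (+-identityˡ 0#)))

  *L-distribʳ : ∀ x y z → ((y +L z) *L x) ≈L ((y *L x) +L (z *L x))
  *L-distribʳ x y z =
    ≈L-trans ((y +L z) *L x) (x *L (y +L z)) ((y *L x) +L (z *L x)) (*L-comm (y +L z) x)
      (≈L-trans (x *L (y +L z)) ((x *L y) +L (x *L z)) ((y *L x) +L (z *L x)) (*L-distribˡ x y z)
        (+L-cong (x *L y) (y *L x) (x *L z) (z *L x) (*L-comm x y) (*L-comm x z)))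

  -- Equality is wrapped in a record
  -- so that both sides can be inferred from an equality proof, and the ring
  -- operations are opaque copies of +L, *L, -L so that unification never
  -- unfolds them into their coefficient formulas.
  record _≈W_ (x y : Laur) : Set ℓ where
    constructor wrap
    field unwrap : x ≈L y
  open _≈W_ public

  infixl 6 _⊕_
  infixl 7 _⊗_
  infix  8 ⊝_

  opaque
    _⊕_ _⊗_ : Laur → Laur → Laur
    x ⊕ y = x +L y
    x ⊗ y = x *L y

    ⊝_ : Laur → Laur
    ⊝ x = -L x

  opaque
    unfolding _⊕_ _⊗_ ⊝_

    ⊕≡+L : ∀ x y → x ⊕ y ≡ x +L y
    ⊕≡+L x y = P.refl

    ⊗≡*L : ∀ x y → x ⊗ y ≡ x *L y
    ⊗≡*L x y = P.refl

    ⊝≡-L : ∀ x → ⊝ x ≡ -L x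
    ⊝≡-L x = P.refl

    ⊕-cong : ∀ {x x′ y y′} → x ≈W x′ → y ≈W y′ → (x ⊕ y) ≈W (x′ ⊕ y′)
    ⊕-cong {x} {x′} {y} {y′} h g = wrap (+L-cong x x′ y y′ (unwrap h) (unwrap g))

    ⊗-cong : ∀ {x x′ y y′} → x ≈W x′ → y ≈W y′ → (x ⊗ y) ≈W (x′ ⊗ y′)
    ⊗-cong {x} {x′} {y} {y′} h g = wrap (*L-cong x x′ y y′ (unwrap h) (unwrap g))

    ⊝-cong : ∀ {x y} → x ≈W y → (⊝ x) ≈W (⊝ y)
    ⊝-cong {x} {y} h = wrap (-L-cong x y (unwrap h))

    ⊕-assoc : ∀ x y z → ((x ⊕ y) ⊕ z) ≈W (x ⊕ (y ⊕ z))
    ⊕-assoc x y z = wrap (+L-assoc x y z)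

    ⊕-comm : ∀ x y → (x ⊕ y) ≈W (y ⊕ x)
    ⊕-comm x y = wrap (+L-comm x y)

    ⊕-identityˡ : ∀ x → (0L ⊕ x) ≈W x
    ⊕-identityˡ x = wrap (+L-identityˡ x)

    ⊕-identityʳ : ∀ x → (x ⊕ 0L) ≈W x
    ⊕-identityʳ x = wrap (+L-identityʳ x)

    ⊝-inverseˡ : ∀ x → ((⊝ x) ⊕ x) ≈W 0L
    ⊝-inverseˡ x = wrap (-L-inverseˡ x)

    ⊝-inverseʳ : ∀ x → (x ⊕ (⊝ x)) ≈W 0L
    ⊝-inverseʳ x = wrap (-L-inverseʳ x)

    ⊗-assoc : ∀ x y z → ((x ⊗ y) ⊗ z) ≈W (x ⊗ (y ⊗ z))
    ⊗-assoc x y z = wrap (*L-assoc x y z)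

    ⊗-comm : ∀ x y → (x ⊗ y) ≈W (y ⊗ x)
    ⊗-comm x y = wrap (*L-comm x y)

    ⊗-identityˡ : ∀ x → (1L ⊗ x) ≈W x
    ⊗-identityˡ x = wrap (*L-identityˡ x)

    ⊗-identityʳ : ∀ x → (x ⊗ 1L) ≈W x
    ⊗-identityʳ x = wrap (*L-identityʳ x)

    ⊗-distribˡ : ∀ x y z → (x ⊗ (y ⊕ z)) ≈W ((x ⊗ y) ⊕ (x ⊗ z))
    ⊗-distribˡ x y z = wrap (*L-distribˡ x y z)

    ⊗-distribʳ : ∀ x y z → ((y ⊕ z) ⊗ x) ≈W ((y ⊗ x) ⊕ (z ⊗ x))
    ⊗-distribʳ x y z = wrap (*L-distribʳ x y z)

  LaurRing : CommutativeRing c ℓ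
  LaurRing = record
    { Carrier = Laur ; _≈_ = _≈W_ ; _+_ = _⊕_ ; _*_ = _⊗_ ; -_ = ⊝_ ; 0# = 0L ; 1# = 1L
    ; isCommutativeRing = record
      { isRing = record
        { +-isAbelianGroup = record
          { isGroup = record
            { isMonoid = record
              { isSemigroup = record
                { isMagma = record
                  { isEquivalence = record
                    { refl = λ {x} → wrap (≈L-refl {x})
                    ; sym = λ {x} {y} h → wrap (≈L-sym {x} {y} (unwrap h))
                    ; trans = λ {x} {y} {z} h g → wrap (≈L-trans x y z (unwrap h) (unwrap g)) }
                  ; ∙-cong = ⊕-cong }
                ; assoc = ⊕-assoc }
              ; identity = ⊕-identityˡ , ⊕-identityʳ }
            ; inverse = ⊝-inverseˡ , ⊝-inverseʳ
            ; ⁻¹-cong = ⊝-cong }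
          ; comm = ⊕-comm }
        ; *-cong = ⊗-cong
        ; *-assoc = ⊗-assoc
        ; *-identity = ⊗-identityˡ , ⊗-identityʳ
        ; distrib = ⊗-distribˡ , ⊗-distribʳ }
      ; *-comm = ⊗-comm } }

  cf-qpow : ∀ a k → cf (qpow a) k ≈ one k
  cf-qpow a zero    = refl
  cf-qpow a (suc k) = refl

  qpow-+ : ∀ a b → (qpow a ⊗ qpow b) ≈W qpow (a ℤ.+ b)
  qpow-+ a b rewrite ⊗≡*L (qpow a) (qpow b) = wrap (≈L-cf (qpow a *L qpow b) (qpow (a ℤ.+ b)) P.refl λ k → begin
    cf (qpow a *L qpow b) k             ≈⟨ cf-* (qpow a) (qpow b) k ⟩
    conv (cf (qpow a)) (cf (qpow b)) k  ≈⟨ conv-cong (cf-qpow a) (cf-qpow b) k ⟩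
    conv one one k                      ≈⟨ conv-identityˡ one k ⟩
    one k                               ≈⟨ sym (cf-qpow (a ℤ.+ b) k) ⟩
    cf (qpow (a ℤ.+ b)) k               ∎)

  qpow-0 : qpow (+ 0) ≈W 1L
  qpow-0 = wrap (≈L-cf (qpow (+ 0)) 1L P.refl λ { zero → refl ; (suc k) → refl })

  lc-qpow-* : ∀ a x e → lc (qpow a ⊗ x) e ≈ lc x (e ℤ.- a)
  lc-qpow-* a x e rewrite ⊗≡*L (qpow a) x = begin
    coefAt ((a ℤ.+ top x) ℤ.- e) (cf (qpow a *L x))  ≈⟨ coefAt-cong ((a ℤ.+ top x) ℤ.- e) cf-shifted ⟩
    coefAt ((a ℤ.+ top x) ℤ.- e) (cf x)              ≡⟨ P.cong (λ z → coefAt z (cf x)) (gap a (top x) e) ⟩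
    coefAt (top x ℤ.- (e ℤ.- a)) (cf x)              ∎
    where
    cf-shifted : ∀ k → cf (qpow a *L x) k ≈ cf x k
    cf-shifted k = trans (cf-* (qpow a) x k) (trans (conv-congˡ (cf x) (cf-qpow a) k) (conv-identityˡ (cf x) k))
    gap : ∀ (a t e : ℤ) → (a ℤ.+ t) ℤ.- e ≡ t ℤ.- (e ℤ.- a)
    gap = solve-∀

  lc-embed-* : ∀ r x e → lc (embed r ⊗ x) e ≈ r * lc x e
  lc-embed-* r x e rewrite ⊗≡*L (embed r) x = begin
    coefAt ((+ 0 ℤ.+ top x) ℤ.- e) (cf (embed r *L x))
      ≡⟨ P.cong (λ z → coefAt (z ℤ.- e) (cf (embed r *L x))) (ℤP.+-identityˡ (top x)) ⟩
    coefAt (top x ℤ.- e) (cf (embed r *L x))  ≈⟨ coefAt-cong (top x ℤ.- e) cf-scaled ⟩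
    coefAt (top x ℤ.- e) (λ k → r * cf x k)   ≈⟨ scale (top x ℤ.- e) ⟩
    r * coefAt (top x ℤ.- e) (cf x)           ∎
    where
    cf-scaled : ∀ k → cf (embed r *L x) k ≈ r * cf x k
    cf-scaled k = trans (cf-* (embed r) x k) (sum-single (suc k) 0 (s≤s z≤n) off)
      where
      off : ∀ i → i < suc k → i ≢ 0 → cf (embed r) i * cf x (k ∸ i) ≈ 0#
      off zero    _ i≢0 = contradiction P.refl i≢0
      off (suc i) _ _   = zeroˡ _
    scale : ∀ z → coefAt z (λ k → r * cf x k) ≈ r * coefAt z (cf x)
    scale (+ k)    = refl
    scale -[1+ _ ] = sym (zeroʳ r)

  lc-⊕ : ∀ x y e → lc (x ⊕ y) e ≈ lc x e + lc y e
  lc-⊕ x y e rewrite ⊕≡+L x y = lc-+ x y e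

  lc-⊝ : ∀ x e → lc (⊝ x) e ≈ - lc x e
  lc-⊝ x e rewrite ⊝≡-L x = lc-neg x e

module Exponents where
  open import Data.Nat as ℕ using (ℕ; zero; suc; _∸_; _≤_)
  import Data.Nat.Properties as ℕP
  open import Data.Nat.Combinatorics using (_C_; nC1≡n; nCk+nC[k+1]≡[n+1]C[k+1])
  open import Data.Nat.Tactic.RingSolver using (solve-∀)
  open import Data.Integer as ℤ using (ℤ; +_)
  import Data.Integer.Properties as ℤP
  import Data.Integer.Tactic.RingSolver as ℤSolver
  open import Relation.Binary.PropositionalEquality as P using (_≡_)
  open P.≡-Reasoning

  *-split : ∀ κ {i a} → i ≤ a → κ ℕ.* a ≡ κ ℕ.* i ℕ.+ κ ℕ.* (a ∸ i)
  *-split κ {i} {a} i≤a =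
    P.trans (P.cong (κ ℕ.*_) (P.sym (ℕP.m+[n∸m]≡n i≤a))) (ℕP.*-distribˡ-+ κ i (a ∸ i))

  t-degree-split : ∀ κ m {i a} → i ≤ a → (m ℕ.+ κ ℕ.* i) ℕ.+ (κ ℕ.* (a ∸ i) ℕ.+ 1) ≡ suc m ℕ.+ κ ℕ.* a
  t-degree-split κ m {i} {a} i≤a = begin
    (m ℕ.+ κ ℕ.* i) ℕ.+ (κ ℕ.* (a ∸ i) ℕ.+ 1) ≡⟨ regroup m (κ ℕ.* i) (κ ℕ.* (a ∸ i)) ⟩
    suc m ℕ.+ (κ ℕ.* i ℕ.+ κ ℕ.* (a ∸ i))     ≡⟨ P.cong (suc m ℕ.+_) (P.sym (*-split κ i≤a)) ⟩
    suc m ℕ.+ κ ℕ.* a                         ∎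
    where
    regroup : ∀ m x y → (m ℕ.+ x) ℕ.+ (y ℕ.+ 1) ≡ suc m ℕ.+ (x ℕ.+ y)
    regroup = solve-∀

  dual-degree-split : ∀ κ {i a} → i ≤ a → κ ℕ.* a ℕ.+ 1 ≡ (i ℕ.* κ ℕ.+ 1) ℕ.+ κ ℕ.* (a ∸ i)
  dual-degree-split κ {i} {a} i≤a =
    P.trans (P.cong (ℕ._+ 1) (*-split κ i≤a)) (regroup κ i (κ ℕ.* (a ∸ i)))
    where
    regroup : ∀ κ i y → (κ ℕ.* i ℕ.+ y) ℕ.+ 1 ≡ (i ℕ.* κ ℕ.+ 1) ℕ.+ y
    regroup = solve-∀

  C2-suc : ∀ n → suc n C 2 ≡ n ℕ.+ n C 2
  C2-suc n = P.trans (P.sym (nCk+nC[k+1]≡[n+1]C[k+1] n 1)) (P.cong (ℕ._+ n C 2) (nC1≡n n))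

  C2-+ : ∀ a b → (a ℕ.+ b) C 2 ≡ a C 2 ℕ.+ b C 2 ℕ.+ a ℕ.* b
  C2-+ a zero = begin
    (a ℕ.+ 0) C 2              ≡⟨ P.cong (_C 2) (ℕP.+-identityʳ a) ⟩
    a C 2                      ≡⟨ regroup (a C 2) a ⟩
    a C 2 ℕ.+ 0 ℕ.+ a ℕ.* 0    ∎
    where
    regroup : ∀ x a → x ≡ x ℕ.+ 0 ℕ.+ a ℕ.* 0
    regroup = solve-∀
  C2-+ a (suc b) = begin
    (a ℕ.+ suc b) C 2                         ≡⟨ P.cong (_C 2) (ℕP.+-suc a b) ⟩
    suc (a ℕ.+ b) C 2                         ≡⟨ C2-suc (a ℕ.+ b) ⟩
    (a ℕ.+ b) ℕ.+ (a ℕ.+ b) C 2               ≡⟨ P.cong ((a ℕ.+ b) ℕ.+_) (C2-+ a b) ⟩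
    (a ℕ.+ b) ℕ.+ (a C 2 ℕ.+ b C 2 ℕ.+ a ℕ.* b) ≡⟨ regroup a b (a C 2) (b C 2) ⟩
    a C 2 ℕ.+ (b ℕ.+ b C 2) ℕ.+ a ℕ.* suc b  ≡⟨ P.cong (λ z → a C 2 ℕ.+ z ℕ.+ a ℕ.* suc b) (P.sym (C2-suc b)) ⟩
    a C 2 ℕ.+ suc b C 2 ℕ.+ a ℕ.* suc b      ∎
    where
    regroup : ∀ a b x y → (a ℕ.+ b) ℕ.+ (x ℕ.+ y ℕ.+ a ℕ.* b) ≡ x ℕ.+ (b ℕ.+ y) ℕ.+ a ℕ.* suc b
    regroup = solve-∀

  q-exponent-split : ∀ κ a N → a ≤ N →
    ℤ.- + (κ ℕ.* (a C 2)) ℤ.+ (ℤ.- + κ) ℤ.* + ((N ∸ a) C 2) ≡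
    (ℤ.- + κ) ℤ.* + (N C 2) ℤ.+ (+ (a ℕ.* κ)) ℤ.* + (N ∸ a)
  q-exponent-split κ a N a≤N = begin
    ℤ.- + (κ ℕ.* (a C 2)) ℤ.+ (ℤ.- + κ) ℤ.* + ((N ∸ a) C 2)
      ≡⟨ P.cong (λ z → ℤ.- z ℤ.+ (ℤ.- + κ) ℤ.* + ((N ∸ a) C 2)) (ℤP.pos-* κ (a C 2)) ⟩
    ℤ.- (+ κ ℤ.* + (a C 2)) ℤ.+ (ℤ.- + κ) ℤ.* + ((N ∸ a) C 2)
      ≡⟨ regroup (+ κ) (+ (a C 2)) (+ ((N ∸ a) C 2)) (+ a) (+ (N ∸ a)) ⟩
    (ℤ.- + κ) ℤ.* (+ (a C 2) ℤ.+ + ((N ∸ a) C 2) ℤ.+ + a ℤ.* + (N ∸ a)) ℤ.+ (+ a ℤ.* + κ) ℤ.* + (N ∸ a)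
      ≡⟨ P.cong₂ (λ u v → (ℤ.- + κ) ℤ.* u ℤ.+ v ℤ.* + (N ∸ a)) (P.sym binomial) (P.sym (ℤP.pos-* a κ)) ⟩
    (ℤ.- + κ) ℤ.* + (N C 2) ℤ.+ (+ (a ℕ.* κ)) ℤ.* + (N ∸ a) ∎
    where
    regroup : ∀ (K A B x y : ℤ) →
      ℤ.- (K ℤ.* A) ℤ.+ (ℤ.- K) ℤ.* B ≡ (ℤ.- K) ℤ.* (A ℤ.+ B ℤ.+ x ℤ.* y) ℤ.+ (x ℤ.* K) ℤ.* y
    regroup = ℤSolver.solve-∀
    binomial : + (N C 2) ≡ + (a C 2) ℤ.+ + ((N ∸ a) C 2) ℤ.+ + a ℤ.* + (N ∸ a)
    binomial = begin
      + (N C 2)                                       ≡⟨ P.cong (λ n → + (n C 2)) (P.sym (ℕP.m+[n∸m]≡n a≤N)) ⟩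
      + ((a ℕ.+ (N ∸ a)) C 2)                         ≡⟨ P.cong +_ (C2-+ a (N ∸ a)) ⟩
      + (a C 2 ℕ.+ (N ∸ a) C 2 ℕ.+ a ℕ.* (N ∸ a))
        ≡⟨ P.trans (ℤP.pos-+ (a C 2 ℕ.+ (N ∸ a) C 2) (a ℕ.* (N ∸ a)))
                   (P.cong₂ ℤ._+_ (ℤP.pos-+ (a C 2) ((N ∸ a) C 2)) (ℤP.pos-* a (N ∸ a))) ⟩
      + (a C 2) ℤ.+ + ((N ∸ a) C 2) ℤ.+ + a ℤ.* + (N ∸ a) ∎

module Eventually where
  open import Data.Nat as ℕ using (ℕ; zero; suc; _≤_; _<_; _≟_)
  import Data.Nat.Properties as ℕP
  open import Data.Product using (∃; _,_)
  open import Relation.Nullary using (yes; no)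
  open import Relation.Binary.PropositionalEquality as P using ()

  eventually-all : ∀ {ℓ} n (Pr : ℕ → ℕ → Set ℓ) → (∀ j → j < n → ∃ λ N → ∀ M → N ≤ M → Pr j M) →
    ∃ λ N → ∀ M → N ≤ M → ∀ j → j < n → Pr j M
  eventually-all zero    Pr h = 0 , λ M _ j ()
  eventually-all (suc n) Pr h
    with eventually-all n Pr (λ j j<n → h j (ℕP.m<n⇒m<1+n j<n)) | h n ℕP.≤-refl
  ... | Nₙ , all<n | N , last = Nₙ ℕ.⊔ N , together
    where
    together : ∀ M → Nₙ ℕ.⊔ N ≤ M → ∀ j → j < suc n → Pr j M
    together M bound j j<1+n with j ≟ n
    ... | yes P.refl = last M (ℕP.≤-trans (ℕP.m≤n⊔m Nₙ N) bound)
    ... | no j≢n     = all<n M (ℕP.≤-trans (ℕP.m≤m⊔n Nₙ N) bound) j (ℕP.≤∧≢⇒< (ℕP.≤-pred j<1+n) j≢n)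

module Proposition {c ℓ : Level} (R : CommutativeRing c ℓ) where
  open import Data.Nat as ℕ using (ℕ; zero; suc; _∸_; _≤_; _<_; _≟_)
  import Data.Nat.Properties as ℕP
  open import Data.Nat.Combinatorics using (_C_)
  open import Data.Integer as ℤ using (ℤ; +_; -1ℤ)
  import Data.Integer.Properties as ℤP
  import Data.Integer.Tactic.RingSolver as ℤSolver
  open import Data.Product using (∃; _,_)
  open import Relation.Nullary using (Dec; yes; no)
  open import Relation.Nullary.Negation using (contradiction)
  open import Relation.Binary.PropositionalEquality as P using (_≡_; _≢_)
  open import Defs
  open Exponents
  open Eventually
  open Series R
  open Laurent R
  module Coef = CommutativeRing R
  module Σᴿ = FiniteSums Coef.commutativeSemiring
  open CommutativeRing LaurRing
  open FiniteSums commutativeSemiring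
  open import Relation.Binary.Reasoning.Setoid setoid
  open import Algebra.Properties.Ring ring using (-‿distribʳ-*; -‿distribˡ-*)
  open import Algebra.Properties.CommutativeSemigroup *-commutativeSemigroup using (interchange; x∙yz≈y∙xz)

  sumL≡sum : ∀ n f → sumL n f ≡ sum n f
  sumL≡sum zero    f = P.refl
  sumL≡sum (suc n) f = P.trans (P.cong (_+L f n) (sumL≡sum n f)) (P.sym (⊕≡+L (sum n f) (f n)))

  indL≡select : ∀ {a} {A : Set a} (d : Dec A) x → indL d x ≡ select d x
  indL≡select (yes _) x = P.refl
  indL≡select (no _)  x = P.refl

  x-L≡x-y : ∀ x y → x -L y ≡ x - y
  x-L≡x-y x y = P.sym (P.trans (⊕≡+L x (- y)) (P.cong (x +L_) (⊝≡-L y)))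

  sumL-*L : ∀ n (f g : ℕ → Laur) → sumL n (λ i → f i *L g i) ≈ sum n (λ i → f i * g i)
  sumL-*L n f g = trans (reflexive (sumL≡sum n _)) (sum-cong-∀ n (λ i → reflexive (P.sym (⊗≡*L (f i) (g i)))))

  *PS≈conv : ∀ f g n → (f *PS g) n ≈ conv f g n
  *PS≈conv f g n = sumL-*L (suc n) f (λ a → g (n ∸ a))

  double-sumL : ∀ n m (f g : ℕ → ℕ → Laur) →
    sumL n (λ i → sumL m (λ j → f i j *L g i j)) ≈ sum n (λ i → sum m (λ j → f i j * g i j))
  double-sumL n m f g = trans (reflexive (sumL≡sum n _)) (sum-cong-∀ n (λ i → sumL-*L m (f i) (g i)))

  lc-sum : ∀ n f e → lc (sum n f) e Coef.≈ Σᴿ.sum n (λ j → lc (f j) e)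
  lc-sum zero    f e = lc-0 e
  lc-sum (suc n) f e = Coef.trans (lc-⊕ (sum n f) (f n) e) (Coef.+-congʳ (lc-sum n f e))

  qpow-^ : ∀ a n → (qpow a ^L n) ≈ qpow (a ℤ.* + n)
  qpow-^ a zero    = sym (trans (reflexive (P.cong qpow (ℤP.*-zeroʳ a))) qpow-0)
  qpow-^ a (suc n) = begin
    (qpow a ^L n) *L qpow a          ≡⟨ P.sym (⊗≡*L _ _) ⟩
    (qpow a ^L n) * qpow a           ≈⟨ *-congʳ (qpow-^ a n) ⟩
    qpow (a ℤ.* + n) * qpow a        ≈⟨ qpow-+ _ _ ⟩
    qpow (a ℤ.* + n ℤ.+ a)           ≡⟨ P.cong qpow exponent ⟩
    qpow (a ℤ.* + suc n)             ∎
    where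
    exponent : a ℤ.* + n ℤ.+ a ≡ a ℤ.* + suc n
    exponent = P.trans (distribute a (+ n)) (P.cong (a ℤ.*_) (P.sym (ℤP.pos-+ 1 n)))
      where
      distribute : ∀ (a x : ℤ) → a ℤ.* x ℤ.+ a ≡ a ℤ.* (+ 1 ℤ.+ x)
      distribute = ℤSolver.solve-∀

  1-^ : ∀ n → (1L ^L n) ≈ 1L
  1-^ zero    = refl
  1-^ (suc n) = trans (reflexive (P.sym (⊗≡*L _ _))) (trans (*-congʳ (1-^ n)) (*-identityʳ 1L))

  dilate : ℤ → PS → PS
  dilate a f k = qpow (a ℤ.* + k) * f k

  dilate-cong : ∀ a {f g : PS} → (∀ k → f k ≈ g k) → ∀ k → dilate a f k ≈ dilate a g k
  dilate-cong a h k = *-congˡ (h k)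

  dilate-0 : ∀ f k → dilate (+ 0) f k ≈ f k
  dilate-0 f k = trans (*-congʳ (trans (reflexive (P.cong qpow (ℤP.*-zeroˡ (+ k)))) qpow-0)) (*-identityˡ _)

  dilate-one : ∀ a k → dilate a one k ≈ one k
  dilate-one a zero    = trans (*-identityʳ _) (trans (reflexive (P.cong qpow (ℤP.*-zeroʳ a))) qpow-0)
  dilate-one a (suc k) = zeroʳ _

  dilate-dilate : ∀ a b f k → dilate a (dilate b f) k ≈ dilate (a ℤ.+ b) f k
  dilate-dilate a b f k = begin
    qpow (a ℤ.* + k) * (qpow (b ℤ.* + k) * f k)  ≈⟨ sym (*-assoc _ _ _) ⟩
    (qpow (a ℤ.* + k) * qpow (b ℤ.* + k)) * f k  ≈⟨ *-congʳ (qpow-+ _ _) ⟩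
    qpow (a ℤ.* + k ℤ.+ b ℤ.* + k) * f k         ≡⟨ P.cong (λ z → qpow z * f k) (P.sym (ℤP.*-distribʳ-+ (+ k) a b)) ⟩
    qpow ((a ℤ.+ b) ℤ.* + k) * f k               ∎

  dilate-conv : ∀ a f g n → dilate a (conv f g) n ≈ conv (dilate a f) (dilate a g) n
  dilate-conv a f g n = trans (sum-*ˡ (suc n) _ _) (sum-cong (suc n) (λ i i≤n → term i (ℕP.≤-pred i≤n)))
    where
    term : ∀ i → i ≤ n →
      qpow (a ℤ.* + n) * (f i * g (n ∸ i)) ≈ (qpow (a ℤ.* + i) * f i) * (qpow (a ℤ.* + (n ∸ i)) * g (n ∸ i))
    term i i≤n = trans (*-congʳ (trans (reflexive (P.cong qpow exponent)) (sym (qpow-+ _ _)))) (interchange _ _ _ _)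
      where
      exponent : a ℤ.* + n ≡ a ℤ.* + i ℤ.+ a ℤ.* + (n ∸ i)
      exponent = P.trans (P.cong (λ z → a ℤ.* z) (P.trans (P.cong (λ m → + m) (P.sym (ℕP.m+[n∸m]≡n i≤n))) (ℤP.pos-+ i (n ∸ i))))
                         (ℤP.*-distribˡ-+ a (+ i) (+ (n ∸ i)))

  coeffU0-theta : ∀ c r B m → coeffU0 (thetaU c r) B m ≈ ((r ^L (m C 2)) *L (c ^L m)) * B m
  coeffU0-theta c r B m = begin
    sumL (suc m) (λ n → thetaU c r n m *L B n)  ≈⟨ sumL-*L (suc m) (λ n → thetaU c r n m) B ⟩
    sum (suc m) (λ n → thetaU c r n m * B n)    ≈⟨ sum-single (suc m) m ℕP.≤-refl off-diagonal ⟩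
    thetaU c r m m * B m                        ≈⟨ *-congʳ (trans (reflexive (indL≡select (m ≟ m) _)) (select-yes (m ≟ m) P.refl)) ⟩
    ((r ^L (m C 2)) *L (c ^L m)) * B m          ∎
    where
    off-diagonal : ∀ n → n < suc m → n ≢ m → thetaU c r n m * B n ≈ 0#
    off-diagonal n _ n≢m = trans (*-congʳ (trans (reflexive (indL≡select (m ≟ n) _))
                                                 (select-no (m ≟ n) (λ m≡n → n≢m (P.sym m≡n))))) (zeroˡ (B n))

  theta-1 : ∀ a B m → coeffU0 (thetaU 1L (qpow a)) B m ≈ qpow (a ℤ.* + (m C 2)) * B m
  theta-1 a B m = trans (coeffU0-theta 1L (qpow a) B m) (*-congʳ (trans (reflexive (P.sym (⊗≡*L _ _)))
                    (trans (*-cong (qpow-^ a (m C 2)) (1-^ m)) (*-identityʳ _))))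

  theta-q : ∀ a b B m → coeffU0 (thetaU (qpow b) (qpow a)) B m ≈ qpow (a ℤ.* + (m C 2)) * dilate b B m
  theta-q a b B m = trans (coeffU0-theta (qpow b) (qpow a) B m) (trans (*-congʳ (trans (reflexive (P.sym (⊗≡*L _ _)))
                      (*-cong (qpow-^ a (m C 2)) (qpow-^ b m)))) (*-assoc _ _ _))

  module Catalan (p : ℕ) (φ : ℕ → Coef.Carrier) where
    κ : ℕ
    κ = p ∸ 1

    P₂ : PS2
    P₂ = catalanP p φ

    phiFactor-form : ∀ n k → phiFactor φ n k ≈ select (k ≟ 0) 1L - embed (φ k) * qpow (ℤ.- + (n ℕ.* k))
    phiFactor-form n k = reflexive (P.trans (x-L≡x-y _ _)
      (P.cong₂ _-_ (indL≡select (k ≟ 0) 1L) (P.sym (⊗≡*L (embed (φ k)) _))))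

    F : PS
    F = phiFactor φ 0

    F-form : ∀ a → F a ≈ select (a ≟ 0) 1L - embed (φ a)
    F-form a = trans (phiFactor-form 0 a) (+-congˡ (-‿cong (trans (*-congˡ qpow-0) (*-identityʳ _))))

    Q : ℕ → PS
    Q zero    = one
    Q (suc m) = conv (Q m) (dilate (+ m) F)

    catalanP-coeff : ∀ a b → P₂ a b ≈ select (b ≟ κ ℕ.* a ℕ.+ 1) (F a)
    catalanP-coeff a b = begin
      P₂ a b
        ≡⟨ P.trans (x-L≡x-y _ _) (P.cong (λ y → tSeries a b - y) (indL≡select (b ≟ κ ℕ.* a ℕ.+ 1) (embed (φ a)))) ⟩
      tSeries a b - select (b ≟ κ ℕ.* a ℕ.+ 1) (embed (φ a))   ≈⟨ by-cases ⟩
      select (b ≟ κ ℕ.* a ℕ.+ 1) (select (a ≟ 0) 1L - embed (φ a))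
        ≈⟨ select-cong (b ≟ κ ℕ.* a ℕ.+ 1) (sym (F-form a)) ⟩
      select (b ≟ κ ℕ.* a ℕ.+ 1) (F a)                         ∎
      where
      by-cases : tSeries a b - select (b ≟ κ ℕ.* a ℕ.+ 1) (embed (φ a)) ≈
                 select (b ≟ κ ℕ.* a ℕ.+ 1) (select (a ≟ 0) 1L - embed (φ a))
      by-cases with b ≟ κ ℕ.* a ℕ.+ 1 | a ≟ 0 | b ≟ 1
      ... | yes _  | yes P.refl | yes _      = refl
      ... | yes b≡ | yes P.refl | no b≢1     = contradiction (P.trans b≡ (P.cong (ℕ._+ 1) (ℕP.*-zeroʳ κ))) b≢1
      ... | yes _  | no _       | _          = refl
      ... | no b≢  | yes P.refl | yes P.refl = contradiction (P.cong (ℕ._+ 1) (P.sym (ℕP.*-zeroʳ κ))) b≢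
      ... | no _   | yes P.refl | no _       = -‿inverseʳ 0L
      ... | no _   | no _       | _          = -‿inverseʳ 0L

    shiftP-coeff : ∀ m a b → shiftP m P₂ a b ≈ select (b ≟ κ ℕ.* a ℕ.+ 1) (dilate (+ m) F a)
    shiftP-coeff m a b = begin
      qpow (+ (m ℕ.* a)) *L P₂ a b                             ≡⟨ P.sym (⊗≡*L _ _) ⟩
      qpow (+ (m ℕ.* a)) * P₂ a b                              ≈⟨ *-congˡ (catalanP-coeff a b) ⟩
      qpow (+ (m ℕ.* a)) * select (b ≟ κ ℕ.* a ℕ.+ 1) (F a)    ≈⟨ select-*ˡ (b ≟ κ ℕ.* a ℕ.+ 1) _ _ ⟩
      select (b ≟ κ ℕ.* a ℕ.+ 1) (qpow (+ (m ℕ.* a)) * F a)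
        ≡⟨ P.cong (λ e → select (b ≟ κ ℕ.* a ℕ.+ 1) (qpow e * F a)) (ℤP.pos-* m a) ⟩
      select (b ≟ κ ℕ.* a ℕ.+ 1) (dilate (+ m) F a)            ∎

    prodShiftP-coeff : ∀ m a b → prodShiftP P₂ m a b ≈ select (b ≟ m ℕ.+ κ ℕ.* a) (Q m a)
    prodShiftP-coeff zero a b with a ≟ 0 | b ≟ 0 | b ≟ κ ℕ.* a
    ... | yes P.refl | yes P.refl | yes _   = refl
    ... | yes P.refl | yes P.refl | no 0≢κ0 = contradiction (P.sym (ℕP.*-zeroʳ κ)) 0≢κ0
    ... | yes P.refl | no b≢0     | yes b≡  = contradiction (P.trans b≡ (ℕP.*-zeroʳ κ)) b≢0
    ... | yes P.refl | no _       | no _    = refl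
    ... | no _       | _          | yes _   = refl
    ... | no _       | _          | no _    = refl
    prodShiftP-coeff (suc m) a b = begin
      prodShiftP P₂ (suc m) a b
        ≈⟨ double-sumL (suc a) (suc b) (λ i j → prodShiftP P₂ m i j) (λ i j → shiftP m P₂ (a ∸ i) (b ∸ j)) ⟩
      sum (suc a) (λ i → sum (suc b) (λ j → prodShiftP P₂ m i j * shiftP m P₂ (a ∸ i) (b ∸ j)))
        ≈⟨ sum-cong-∀ (suc a) (λ i → sum-cong-∀ (suc b) (λ j →
             *-cong (prodShiftP-coeff m i j) (shiftP-coeff m (a ∸ i) (b ∸ j)))) ⟩
      sum (suc a) (λ i → sum (suc b) (λ j →
        select (j ≟ m ℕ.+ κ ℕ.* i) (Q m i) * select (b ∸ j ≟ κ ℕ.* (a ∸ i) ℕ.+ 1) (G (a ∸ i))))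
        ≈⟨ sum-cong (suc a) (λ i i≤a → trans (sum-degrees b _ _ _ _) (same-degree (ℕP.≤-pred i≤a) _)) ⟩
      sum (suc a) (λ i → select (b ≟ suc m ℕ.+ κ ℕ.* a) (Q m i * G (a ∸ i)))
        ≈⟨ sum-select (suc a) (b ≟ suc m ℕ.+ κ ℕ.* a) _ ⟩
      select (b ≟ suc m ℕ.+ κ ℕ.* a) (Q (suc m) a) ∎
      where
      G : PS
      G = dilate (+ m) F
      same-degree : ∀ {i} → i ≤ a → ∀ x →
        select (b ≟ (m ℕ.+ κ ℕ.* i) ℕ.+ (κ ℕ.* (a ∸ i) ℕ.+ 1)) x ≈ select (b ≟ suc m ℕ.+ κ ℕ.* a) x
      same-degree i≤a x rewrite t-degree-split κ m i≤a = refl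

    predual-coeff : ∀ {i a} i₂ b → i ≤ a → predual P₂ i i₂ a b ≡ prodShiftP P₂ i₂ (a ∸ i) b
    predual-coeff {i} {a} i₂ b i≤a with a ℕ.<? i
    ... | yes a<i = contradiction i≤a (ℕP.<⇒≱ a<i)
    ... | no _    = P.refl

    diag : ℕ → ℕ
    diag i = i ℕ.* κ ℕ.+ 1

    dual-diagonal : ∀ T → IsDualCoeffs P₂ T → ∀ a → zSum (λ i → T i (diag i)) (λ i → Q (diag i)) a ≈ one a
    dual-diagonal T dual a = begin
      sum (suc a) (λ i → T i (diag i) * Q (diag i) (a ∸ i))
        ≈⟨ sym (sum-cong (suc a) (λ i i≤a → column i (ℕP.≤-pred i≤a))) ⟩
      sum (suc a) (λ i → sum (suc b) (λ i₂ → T i i₂ * predual P₂ i i₂ a b))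
        ≈⟨ sym (double-sumL (suc a) (suc b) T (λ i i₂ → predual P₂ i i₂ a b)) ⟩
      sumL (suc a) (λ i → sumL (suc b) (λ i₂ → T i i₂ *L predual P₂ i i₂ a b))  ≈⟨ wrap (dual a b) ⟩
      tSeries a b                                                               ≈⟨ t-coefficient ⟩
      one a                                                                     ∎
      where
      b : ℕ
      b = κ ℕ.* a ℕ.+ 1
      column : ∀ i → i ≤ a →
        sum (suc b) (λ i₂ → T i i₂ * predual P₂ i i₂ a b) ≈ T i (diag i) * Q (diag i) (a ∸ i)
      column i i≤a = begin
        sum (suc b) (λ i₂ → T i i₂ * predual P₂ i i₂ a b)
          ≈⟨ sum-cong-∀ (suc b) (λ i₂ → *-congˡ (trans (reflexive (predual-coeff i₂ b i≤a))
                                                       (prodShiftP-coeff i₂ (a ∸ i) b))) ⟩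
        sum (suc b) (λ i₂ → T i i₂ * select (b ≟ i₂ ℕ.+ κ ℕ.* (a ∸ i)) (Q i₂ (a ∸ i)))
          ≈⟨ sum-select-index b (diag i) (κ ℕ.* (a ∸ i)) (T i) (λ i₂ → Q i₂ (a ∸ i)) (dual-degree-split κ i≤a) ⟩
        T i (diag i) * Q (diag i) (a ∸ i) ∎
      t-coefficient : tSeries a b ≈ one a
      t-coefficient with a ≟ 0
      ... | yes P.refl = trans (reflexive (indL≡select (κ ℕ.* 0 ℕ.+ 1 ≟ 1) 1L))
                               (select-yes (κ ℕ.* 0 ℕ.+ 1 ≟ 1) (P.cong (ℕ._+ 1) (ℕP.*-zeroʳ κ)))
      ... | no _       = refl

    phiFactor-suc : ∀ n k → phiFactor φ (suc n) k ≈ dilate -1ℤ (phiFactor φ n) k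
    phiFactor-suc n k = sym (begin
      q * phiFactor φ n k                          ≈⟨ *-congˡ (phiFactor-form n k) ⟩
      q * (select (k ≟ 0) 1L - e * qpow (ℤ.- + (n ℕ.* k)))
        ≈⟨ trans (distribˡ _ _ _) (+-cong (dilate-one -1ℤ k) (sym (-‿distribʳ-* _ _))) ⟩
      select (k ≟ 0) 1L - q * (e * qpow (ℤ.- + (n ℕ.* k)))
        ≈⟨ +-congˡ (-‿cong (trans (x∙yz≈y∙xz q e _) (*-congˡ (trans (qpow-+ _ _) (reflexive (P.cong qpow exponent)))))) ⟩
      select (k ≟ 0) 1L - e * qpow (ℤ.- + (suc n ℕ.* k)) ≈⟨ sym (phiFactor-form (suc n) k) ⟩
      phiFactor φ (suc n) k                        ∎)
      where
      q = qpow (-1ℤ ℤ.* + k)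
      e = embed (φ k)
      exponent : -1ℤ ℤ.* + k ℤ.+ ℤ.- + (n ℕ.* k) ≡ ℤ.- + (suc n ℕ.* k)
      exponent = P.trans (P.cong (ℤ._+ ℤ.- + (n ℕ.* k)) (ℤP.-1*i≡-i (+ k)))
        (P.trans (P.sym (ℤP.neg-distrib-+ (+ k) (+ (n ℕ.* k)))) (P.cong ℤ.-_ (P.sym (ℤP.pos-+ k (n ℕ.* k)))))

    partialΦ-suc : ∀ M k → partialΦ φ (suc M) k ≈ conv F (dilate -1ℤ (partialΦ φ M)) k
    partialΦ-suc zero k = begin
      (partialΦ φ 0 *PS F) k            ≈⟨ *PS≈conv (partialΦ φ 0) F k ⟩
      conv (partialΦ φ 0) F k           ≈⟨ conv-congˡ F partialΦ-0 k ⟩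
      conv one F k                      ≈⟨ trans (conv-identityˡ F k) (sym (conv-identityʳ F k)) ⟩
      conv F one k                      ≈⟨ conv-congʳ F (λ j → sym (trans (dilate-cong -1ℤ partialΦ-0 j) (dilate-one -1ℤ j))) k ⟩
      conv F (dilate -1ℤ (partialΦ φ 0)) k ∎
      where
      partialΦ-0 : ∀ j → partialΦ φ 0 j ≈ one j
      partialΦ-0 j = reflexive (indL≡select (j ≟ 0) 1L)
    partialΦ-suc (suc M) k = begin
      (Ψ (suc M) *PS phiFactor φ (suc M)) k     ≈⟨ *PS≈conv (Ψ (suc M)) (phiFactor φ (suc M)) k ⟩
      conv (Ψ (suc M)) (phiFactor φ (suc M)) k  ≈⟨ conv-cong (partialΦ-suc M) (phiFactor-suc M) k ⟩
      conv (conv F (dilate -1ℤ (Ψ M))) (dilate -1ℤ (phiFactor φ M)) k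
        ≈⟨ sym (conv-assoc F (dilate -1ℤ (Ψ M)) (dilate -1ℤ (phiFactor φ M)) k) ⟩
      conv F (conv (dilate -1ℤ (Ψ M)) (dilate -1ℤ (phiFactor φ M))) k
        ≈⟨ conv-congʳ F (λ j → sym (trans (dilate-cong -1ℤ (*PS≈conv (Ψ M) (phiFactor φ M)) j)
                                          (dilate-conv -1ℤ (Ψ M) (phiFactor φ M) j))) k ⟩
      conv F (dilate -1ℤ (Ψ (suc M))) k         ∎
      where
      Ψ : ℕ → PS
      Ψ = partialΦ φ

    F-scalar : ℕ → Coef.Carrier → Coef.Carrier
    F-scalar j v = Σᴿ.select (j ≟ 0) v Coef.- φ j Coef.* v

    F-scalar-cong : ∀ j {v w} → v Coef.≈ w → F-scalar j v Coef.≈ F-scalar j w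
    F-scalar-cong j v≈w = Coef.+-cong (Σᴿ.select-cong (j ≟ 0) v≈w) (Coef.-‿cong (Coef.*-congˡ v≈w))

    lc-F-* : ∀ j Y e → lc (F j * Y) e Coef.≈ F-scalar j (lc Y e)
    lc-F-* j Y e = Coef.trans (unwrap distributed e)
      (Coef.trans (lc-⊕ _ _ e) (Coef.+-cong (lc-select (j ≟ 0)) (Coef.trans (lc-⊝ _ e) (Coef.-‿cong (lc-embed-* (φ j) Y e)))))
      where
      distributed : F j * Y ≈ select (j ≟ 0) 1L * Y - embed (φ j) * Y
      distributed = trans (*-congʳ (F-form j)) (trans (distribʳ Y _ _) (+-congˡ (sym (-‿distribˡ-* _ Y))))
      lc-select : ∀ {a} {A : Set a} (d : Dec A) → lc (select d 1L * Y) e Coef.≈ Σᴿ.select d (lc Y e)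
      lc-select (yes _) = unwrap (*-identityˡ Y) e
      lc-select (no _)  = Coef.trans (unwrap (zeroˡ Y) e) (lc-0 e)

    -- the exponent of q in X_(k-j) contributing to q^e in (F · X(u/q))_k
    source : ℤ → ℕ → ℕ → ℤ
    source e k j = e ℤ.- -1ℤ ℤ.* + (k ∸ j)

    -- the coefficient of u^k q^e in F(u)·X(u/q) is a fixed R-linear combination
    -- of finitely many coefficients of X
    lc-F-dilate : ∀ X k e → lc (conv F (dilate -1ℤ X) k) e Coef.≈
                            Σᴿ.sum (suc k) (λ j → F-scalar j (lc (X (k ∸ j)) (source e k j)))
    lc-F-dilate X k e = Coef.trans (lc-sum (suc k) _ e) (Σᴿ.sum-cong-∀ (suc k) (λ j →
      Coef.trans (lc-F-* j _ e) (F-scalar-cong j (lc-qpow-* (-1ℤ ℤ.* + (k ∸ j)) (X (k ∸ j)) e))))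

    -- passing to the limit in partialΦ-suc:  Φ(u) = F(u) Φ(u/q)
    Φ-functional : ∀ Φ → IsInfProdΦ φ Φ → ∀ k → Φ k ≈ conv F (dilate -1ℤ Φ) k
    Φ-functional Φ lim k = wrap λ e →
      limit e (lim k e) (eventually-all (suc k) (stable e) (λ j _ → lim (k ∸ j) (source e k j)))
      where
      stable : ℤ → ℕ → ℕ → Set ℓ
      stable e j M = lc (partialΦ φ M (k ∸ j)) (source e k j) Coef.≈ lc (Φ (k ∸ j)) (source e k j)
      limit : ∀ e → (∃ λ N → ∀ M → N ≤ M → lc (partialΦ φ M k) e Coef.≈ lc (Φ k) e) →
              (∃ λ N → ∀ M → N ≤ M → ∀ j → j < suc k → stable e j M) →
              lc (Φ k) e Coef.≈ lc (conv F (dilate -1ℤ Φ) k) e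
      -- for M ≥ N₀, N₁ both Φ_k and the finitely many coefficients of Φ that
      -- determine (F · Φ(u/q))_k are attained by the M-th partial products
      limit e (N₀ , stable₀) (N₁ , stable₁) =
        Coef.trans (Coef.sym (stable₀ (suc M) (ℕP.≤-trans (ℕP.m≤m⊔n N₀ N₁) (ℕP.n≤1+n M))))
        (Coef.trans (unwrap (partialΦ-suc M k) e)
        (Coef.trans (lc-F-dilate (partialΦ φ M) k e)
        (Coef.trans (Σᴿ.sum-cong (suc k) (λ j j≤k → F-scalar-cong j (stable₁ M (ℕP.m≤n⊔m N₀ N₁) j j≤k)))
                    (Coef.sym (lc-F-dilate Φ k e)))))
        where
        M = N₀ ℕ.⊔ N₁

    Φ-dilate : ∀ Φ → IsInfProdΦ φ Φ → ∀ m k → dilate (+ m) Φ k ≈ conv (Q (suc m)) (dilate -1ℤ Φ) k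
    Φ-dilate Φ lim zero k = begin
      dilate (+ 0) Φ k           ≈⟨ dilate-0 Φ k ⟩
      Φ k                        ≈⟨ Φ-functional Φ lim k ⟩
      conv F (dilate -1ℤ Φ) k    ≈⟨ conv-congˡ (dilate -1ℤ Φ) (λ j → sym (trans (conv-identityˡ (dilate (+ 0) F) j) (dilate-0 F j))) k ⟩
      conv (Q 1) (dilate -1ℤ Φ) k ∎
    Φ-dilate Φ lim (suc m) k = begin
      dilate (+ suc m) Φ k
        ≈⟨ dilate-cong (+ suc m) (Φ-functional Φ lim) k ⟩
      dilate (+ suc m) (conv F (dilate -1ℤ Φ)) k
        ≈⟨ dilate-conv (+ suc m) F (dilate -1ℤ Φ) k ⟩
      conv G (dilate (+ suc m) (dilate -1ℤ Φ)) k
        ≈⟨ conv-congʳ G (dilate-dilate (+ suc m) -1ℤ Φ) k ⟩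
      conv G (dilate (+ m) Φ) k
        ≈⟨ conv-congʳ G (Φ-dilate Φ lim m) k ⟩
      conv G (conv (Q (suc m)) (dilate -1ℤ Φ)) k
        ≈⟨ conv-assoc G (Q (suc m)) (dilate -1ℤ Φ) k ⟩
      conv (conv G (Q (suc m))) (dilate -1ℤ Φ) k
        ≈⟨ conv-congˡ (dilate -1ℤ Φ) (conv-comm G (Q (suc m))) k ⟩
      conv (Q (suc (suc m))) (dilate -1ℤ Φ) k ∎
      where
      G : PS
      G = dilate (+ suc m) F

    -- multiplying the diagonal duality by Φ(z/q):  Σ_i T_(i,iκ+1) z^i Φ(q^(iκ) z) = Φ(z/q)
    dual-Φ : ∀ T Φ → IsDualCoeffs P₂ T → IsInfProdΦ φ Φ → ∀ N →
      zSum (λ i → T i (diag i)) (λ i → dilate (+ (i ℕ.* κ)) Φ) N ≈ dilate -1ℤ Φ N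
    dual-Φ T Φ dual lim N = begin
      zSum T′ (λ i → dilate (+ (i ℕ.* κ)) Φ) N       ≈⟨ zSum-cong T′ Φ-dilate-diag N ⟩
      zSum T′ (λ i → conv (Q (diag i)) Φ/q) N        ≈⟨ sym (zSum-conv T′ (λ i → Q (diag i)) Φ/q N) ⟩
      conv (zSum T′ (λ i → Q (diag i))) Φ/q N        ≈⟨ conv-congˡ Φ/q (dual-diagonal T dual) N ⟩
      conv one Φ/q N                                 ≈⟨ conv-identityˡ Φ/q N ⟩
      Φ/q N                                          ∎
      where
      T′ : ℕ → Laur
      T′ i = T i (diag i)
      Φ/q : PS
      Φ/q = dilate -1ℤ Φ
      Φ-dilate-diag : ∀ i k → dilate (+ (i ℕ.* κ)) Φ k ≈ conv (Q (diag i)) Φ/q k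
      Φ-dilate-diag i k =
        P.subst (λ j → dilate (+ (i ℕ.* κ)) Φ k ≈ conv (Q j) Φ/q k) (ℕP.+-comm 1 (i ℕ.* κ)) (Φ-dilate Φ lim (i ℕ.* κ) k)

    product-term : ∀ T Φ N a → a ≤ N →
      calT p T a * coeffU0 (thetaU 1L (qpow (ℤ.- + κ))) Φ (N ∸ a) ≈
      qpow (ℤ.- + κ ℤ.* + (N C 2)) * (T a (diag a) * dilate (+ (a ℕ.* κ)) Φ (N ∸ a))
    product-term T Φ N a a≤N = begin
      calT p T a * coeffU0 (thetaU 1L (qpow (ℤ.- + κ))) Φ (N ∸ a)
        ≈⟨ *-cong (reflexive (P.sym (⊗≡*L _ _))) (theta-1 (ℤ.- + κ) Φ (N ∸ a)) ⟩
      (q₁ * T a (diag a)) * (q₂ * Φ (N ∸ a))   ≈⟨ interchange q₁ (T a (diag a)) q₂ (Φ (N ∸ a)) ⟩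
      (q₁ * q₂) * (T a (diag a) * Φ (N ∸ a))
        ≈⟨ *-congʳ (trans (qpow-+ _ _) (trans (reflexive (P.cong qpow (q-exponent-split κ a N a≤N))) (sym (qpow-+ _ _)))) ⟩
      (qE * qF) * (T a (diag a) * Φ (N ∸ a))   ≈⟨ *-assoc _ _ _ ⟩
      qE * (qF * (T a (diag a) * Φ (N ∸ a)))   ≈⟨ *-congˡ (x∙yz≈y∙xz qF (T a (diag a)) (Φ (N ∸ a))) ⟩
      qE * (T a (diag a) * dilate (+ (a ℕ.* κ)) Φ (N ∸ a)) ∎
      where
      q₁ = qpow (ℤ.- + (κ ℕ.* (a C 2)))
      q₂ = qpow ((ℤ.- + κ) ℤ.* + ((N ∸ a) C 2))
      qE = qpow ((ℤ.- + κ) ℤ.* + (N C 2))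
      qF = qpow (+ (a ℕ.* κ) ℤ.* + (N ∸ a))

    main-identity : ∀ T Φ → IsDualCoeffs P₂ T → IsInfProdΦ φ Φ → ∀ N →
      (calT p T *PS coeffU0 (thetaU 1L (qpow (ℤ.- + κ))) Φ) N ≈ coeffU0 (thetaU (qpow -1ℤ) (qpow (ℤ.- + κ))) Φ N
    main-identity T Φ dual lim N = begin
      (calT p T *PS D) N                            ≈⟨ *PS≈conv (calT p T) D N ⟩
      conv (calT p T) D N                           ≈⟨ sum-cong (suc N) (λ a a≤N → product-term T Φ N a (ℕP.≤-pred a≤N)) ⟩
      sum (suc N) (λ a → qE * (T′ a * dilate (+ (a ℕ.* κ)) Φ (N ∸ a)))
                                                    ≈⟨ sym (sum-*ˡ (suc N) qE _) ⟩
      qE * zSum T′ (λ a → dilate (+ (a ℕ.* κ)) Φ) N ≈⟨ *-congˡ (dual-Φ T Φ dual lim N) ⟩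
      qE * dilate -1ℤ Φ N                           ≈⟨ sym (theta-q (ℤ.- + κ) -1ℤ Φ N) ⟩
      coeffU0 (thetaU (qpow -1ℤ) (qpow (ℤ.- + κ))) Φ N ∎
      where
      D : PS
      D = coeffU0 (thetaU 1L (qpow (ℤ.- + κ))) Φ
      qE : Laur
      qE = qpow (ℤ.- + κ ℤ.* + (N C 2))
      T′ : ℕ → Laur
      T′ a = T a (diag a)

open import Defs
open import Level using (Level)
open import Algebra.Bundles using (CommutativeRing)
open import Data.Nat using (ℕ; _≤_; _∸_)
open import Data.Integer using (+_; -_)
open import Relation.Nullary using (¬_)
open Series using (Laur; PS; IsDualCoeffs; catalanP; IsInfProdΦ; _≈PS_; _*PS_; calT; coeffU0; thetaU; 1L; qpow)
open CommutativeRing using (Carrier; _≈_; 0#)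

proposition5p7 : ∀ {c ℓ : Level} (R : CommutativeRing c ℓ) →
    (p : ℕ) → 2 ≤ p →
    (φ : ℕ → Carrier R) → _≈_ R (φ 0) (0# R) → ¬ (_≈_ R (φ 1) (0# R)) →
    (T : ℕ → ℕ → Laur R) → IsDualCoeffs R (catalanP R p φ) T →
    (Φ : PS R) → IsInfProdΦ R φ Φ →
    _≈PS_ R
      (_*PS_ R (calT R p T)
        (coeffU0 R (thetaU R (1L R) (qpow R (- (+ (p ∸ 1))))) Φ))
      (coeffU0 R (thetaU R (qpow R (- (+ 1))) (qpow R (- (+ (p ∸ 1))))) Φ)
proposition5p7 R p _ φ _ _ T dual Φ lim N =
  unwrap (Proposition.Catalan.main-identity R p φ T Φ dual lim N)
  where open Laurent R using (unwrap)
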